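{- Let $g,n\in\mathbb{N}$ with $g>3$ and $2\le n\le g-2$. The oriented graph $\mathcal{T}_{g,n}$ is a rooted tree whose root is $S_{g,n}$. Moreover, for $T\in\mathcal{H}_{g,n}$, the children of $T$ in $\mathcal{T}_{g,n}$ (the $S$ with $(S,T)$ an edge) are exactly the semigroups $(T\cup\{h\})\setminus\{y\}$ where $h\in\operatorname{SG}(T)$ with $h<\operatorname{m}(T)$, and $y$ is a minimal generator of $T\cup\{h\}$ with $y\neq h$ such that: if $T\cup\{h\}$ is irreducible then $\frac{\operatorname{F}(T)}{2}<y<\operatorname{F}(T)$; and if $T\cup\{h\}$ is not irreducible then $\max\big(\operatorname{SG}(T\cup\{h\})\setminus\{\operatorname{F}(T)\}\big)<y<\operatorname{F}(T)$.
   Context: $\mathbb{N}=\{0,1,2,\ldots\}$. A numerical semigroup is a submonoid $S$ of $(\mathbb{N},+)$ with $\mathbb{N}\setminus S$ finite; a minimal generator is an element of $S\setminus\{0\}$ not expressible as a sum of two elements of $S\setminus\{0\}$. $\operatorname{H}(S)=\mathbb{N}\setminus S$; $\operatorname{g}(S)=|\operatorname{H}(S)|$; $\operatorname{F}(S)=\max\operatorname{H}(S)$; $\operatorname{m}(S)=\min(S\setminus\{0\})$; $\operatorname{n}(S)=|\{s\in S\mid s<\operatorname{F}(S)\}|$. Special gaps: $\operatorname{SG}(S)=\{h\in\operatorname{H}(S)\mid 2h\in S \text{ and } h+s\in S \text{ for all } s\in S\setminus\{0\}\}$. $S$ is special if there is no $h\in\operatorname{SG}(S)\setminus\{\operatorname{F}(S)\}$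 with $h>\operatorname{m}(S)$. $S$ is irreducible if it cannot be written as the intersection of two numerical semigroups properly containing $S$. For non special $S$, $\mathcal{A}(S)=(S\cup\{h\})\setminus\{\operatorname{m}(S)\}$ with $h=\max(\operatorname{SG}(S)\setminus\{\operatorname{F}(S)\})$. $S_{g,n}=\{0\}\cup\{g,\ldots,g+n-2\}\cup\{x\in\mathbb{N}\mid x\ge g+n\}$ (the almost-ordinary semigroup of genus $g$ with $\operatorname{n}(S_{g,n})=n$). $\mathcal{H}_{g,n}$ is the set consisting of $S_{g,n}$ and all non special numerical semigroups $S$ with $\operatorname{g}(S)=g$, $\operatorname{n}(S)=n$. $\mathcal{T}_{g,n}$ is the oriented graph with vertex set $\mathcal{H}_{g,n}$ and edge set all pairs $(S,\mathcal{A}(S))$ with $S\in\mathcal{H}_{g,n}$ non special. An oriented graph is a rooted tree with root $r$ if for every other vertex $x$ there is a unique path (sequence of distinct edges $(v_0,v_1),\ldots,(v_{k-1},v_k)$ with $v_0=x$, $v_k=r$) from $x$ to $r$. -}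

module Defs where

open import Data.Nat using (ℕ; zero; suc; _+_; _*_; _∸_; _≤_; _<_; _≡ᵇ_; _≤ᵇ_; _<ᵇ_; _⊔_)
open import Data.Bool using (Bool; true; false; not; _∧_; _∨_; if_then_else_)
open import Data.List using (List; []; _∷_; length; filterᵇ; upTo; foldr; zip; drop; _∷ʳ_)
open import Data.List.Relation.Unary.All using (All)
open import Data.List.Relation.Unary.Linked using (Linked)
open import Data.List.Relation.Unary.AllPairs using (AllPairs)
open import Data.List.Relation.Binary.Pointwise using (Pointwise)
open import Data.Product using (_×_; _,_; ∃; ∃₂; Σ)
open import Data.Sum using (_⊎_)
open import Relation.Nullary using (¬_)
open import Relation.Binary.PropositionalEquality using (_≡_; _≢_)

BSet : Set
BSet = ℕ → Bool

_∈ᵇ_ : ℕ → BSet → Set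
x ∈ᵇ P = P x ≡ true

_∉ᵇ_ : ℕ → BSet → Set
x ∉ᵇ P = P x ≡ false

insert : BSet → ℕ → BSet
insert P h x = P x ∨ (x ≡ᵇ h)

remove : BSet → ℕ → BSet
remove P y x = P x ∧ not (x ≡ᵇ y)

_≐_ : BSet → BSet → Set
P ≐ Q = ∀ x → P x ≡ Q x

record NumSemigroup : Set where
  field
    mem      : BSet
    bound    : ℕ
    has0     : 0 ∈ᵇ mem
    closed   : ∀ x y → x ∈ᵇ mem → y ∈ᵇ mem → (x + y) ∈ᵇ mem
    cofinite : ∀ x → bound ≤ x → x ∈ᵇ mem

open NumSemigroup public

_≈S_ : NumSemigroup → NumSemigroup → Set
S ≈S T = mem S ≐ mem T

-- the list of gaps H(S) (all gaps are < bound S)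
gaps : NumSemigroup → List ℕ
gaps S = filterᵇ (λ x → not (mem S x)) (upTo (bound S))

genus : NumSemigroup → ℕ
genus S = length (gaps S)

-- Frobenius number F(S) = max H(S)
-- (junk value 0 for S = ℕ, which has no gaps and never occurs below)
frob : NumSemigroup → ℕ
frob S = foldr _⊔_ 0 (gaps S)

findFrom : BSet → ℕ → ℕ → ℕ
findFrom P x zero    = x
findFrom P x (suc k) = if P x then x else findFrom P (suc x) k

mult : NumSemigroup → ℕ
mult S = findFrom (mem S) 1 (bound S)

nS : NumSemigroup → ℕ
nS S = length (filterᵇ (mem S) (upTo (frob S)))

-- Notions defined for an arbitrary subset P of ℕ (used for S and S ∪ {h})

IsSpecialGap : BSet → ℕ → Set
IsSpecialGap P h =
  h ∉ᵇ P × (2 * h) ∈ᵇ P × (∀ s → s ∈ᵇ P → s ≢ 0 → (h + s) ∈ᵇ P)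

IsMinGen : BSet → ℕ → Set
IsMinGen P y =
  y ∈ᵇ P × y ≢ 0 ×
  (∀ a b → a ∈ᵇ P → b ∈ᵇ P → a ≢ 0 → b ≢ 0 → a + b ≢ y)

ProperlyContains : NumSemigroup → BSet → Set
ProperlyContains S P =
  (∀ x → x ∈ᵇ P → x ∈ᵇ mem S) × ∃ λ x → x ∈ᵇ mem S × x ∉ᵇ P

Irreducible : BSet → Set
Irreducible P =
  ¬ (Σ NumSemigroup λ S₁ → Σ NumSemigroup λ S₂ →
       ProperlyContains S₁ P × ProperlyContains S₂ P ×
       (∀ x → P x ≡ (mem S₁ x ∧ mem S₂ x)))

IsMaxOf : (ℕ → Set) → ℕ → Set
IsMaxOf Q m = Q m × (∀ x → Q x → x ≤ m)

IsSpecial : NumSemigroup → Set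
IsSpecial S = ¬ (∃ λ h → IsSpecialGap (mem S) h × h ≢ frob S × mult S < h)

NonSpecial : NumSemigroup → Set
NonSpecial S = ¬ IsSpecial S

IsA : NumSemigroup → NumSemigroup → Set
IsA S T = ∃ λ h →
  IsMaxOf (λ x → IsSpecialGap (mem S) x × x ≢ frob S) h ×
  (mem T ≐ remove (insert (mem S) h) (mult S))

Sgn : ℕ → ℕ → BSet
Sgn g n x = (x ≡ᵇ 0) ∨ ((g ≤ᵇ x) ∧ (x <ᵇ g + n ∸ 1)) ∨ (g + n ≤ᵇ x)

InH : ℕ → ℕ → NumSemigroup → Set
InH g n S = (mem S ≐ Sgn g n) ⊎ (NonSpecial S × genus S ≡ g × nS S ≡ n)

Edge : ℕ → ℕ → NumSemigroup → NumSemigroup → Set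
Edge g n S T = InH g n S × NonSpecial S × IsA S T

module Graph {A : Set} (_≈_ : A → A → Set) (V : A → Set) (E : A → A → Set) where

  edgesOf : List A → List (A × A)
  edgesOf vs = zip vs (drop 1 vs)

  _≈E_ : A × A → A × A → Set
  (a , b) ≈E (c , d) = (a ≈ c) × (b ≈ d)

  record IsPath (x r : A) (vs : List A) : Set where
    field
      vertices : All V vs
      linked   : Linked E vs
      distinct : AllPairs (λ e e′ → ¬ (e ≈E e′)) (edgesOf vs)
      start    : ∃₂ λ v t → vs ≡ v ∷ t × v ≈ x
      end      : ∃₂ λ t v → vs ≡ t ∷ʳ v × v ≈ r

  IsRootedTree : A → Set
  IsRootedTree r =
    V r ×
    (∀ x → V x → ¬ (x ≈ r) →
       (∃ λ vs → IsPath x r vs) ×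
       (∀ vs ws → IsPath x r vs → IsPath x r ws → Pointwise _≈_ vs ws))


ChildData : NumSemigroup → ℕ → ℕ → Set
ChildData T h y =
  IsSpecialGap (mem T) h × h < mult T ×
  IsMinGen (insert (mem T) h) y × y ≢ h ×
  (Irreducible (insert (mem T) h) → frob T < 2 * y × y < frob T) ×
  (¬ Irreducible (insert (mem T) h) →
     ∃ λ k → IsMaxOf (λ x → IsSpecialGap (insert (mem T) h) x × x ≢ frob T) k
             × k < y × y < frob T)

-- Let S have Frobenius number F and multiplicity m. If w and F − w are gaps and 2w ≠ F, one
-- reaches a special gap v ≠ F with F < 2v by moving upwards: to F − w while w < F/2, and from a
-- non special w to a gap w + s with s ∈ S. Hence a special S either has F < 2m, and then
-- S = {0} ∪ [m, F) ∪ (F, ∞), which for genus g and n(S) = n is S_{g,n}; or 2m < F, and then z or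
-- F − z lies in S for every z ≤ F but F/2, which forces g ≤ n + 1. The map A exchanges m with the
-- greatest special gap h ≠ F; it preserves F, g and n and increases m, so iterating it from any
-- vertex reaches a special semigroup, the root, along a path that is unique because A is a
-- function. Reversing one step, S = (A(S) ∪ {m}) ∖ {h}, where h > F/2 is a minimal generator of
-- A(S) ∪ {m} lying above all of its special gaps other than F, and A(S) ∪ {m} is irreducible
-- exactly when F is its only special gap.

module Submission where

open import Defs
open import Data.Nat using (ℕ; zero; suc; _+_; _*_; _∸_; _≤_; _<_; _⊔_; z≤n; s≤s; _≟_; _≤?_; _<?_; _≤ᵇ_; _<ᵇ_; _≡ᵇ_)
open import Data.Nat.Properties
open import Data.Nat.Induction using (<-wellFounded)
open import Data.Bool using (Bool; true; false; not; _∧_; _∨_; if_then_else_)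
open import Data.Bool.Properties
  using (T-≡; T-not-≡; not-¬; ¬-not; not-injective; ∨-identityʳ; ∧-identityʳ; ∧-zeroʳ; ∨-conicalˡ; ∨-conicalʳ)
  renaming (_≟_ to _≟ᵇ_)
open import Data.List using ([]; _∷_; [_]; _++_; _∷ʳ_; length; filterᵇ; upTo; zip)
open import Data.List.Properties using (upTo-∷ʳ; filter-++; length-++; foldr-preservesᵒ; ∷-injectiveʳ; ∷ʳ-injective)
open import Data.List.Membership.Propositional using (_∈_)
open import Data.List.Membership.Propositional.Properties using (∈-filter⁺; ∈-filter⁻; ∈-upTo⁺; foldr-selective)
open import Data.List.Relation.Unary.Any as Any using ()
open import Data.List.Relation.Unary.All as All using (All; []; _∷_)
open import Data.List.Relation.Unary.Linked using ([-]; _∷_)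
open import Data.List.Relation.Unary.AllPairs using ([]; _∷_)
open import Data.List.Relation.Binary.Pointwise using (Pointwise; []; _∷_)
open import Data.Product using (_×_; _,_; Σ; ∃; ∃₂; proj₁; proj₂)
open import Data.Sum using (_⊎_; inj₁; inj₂)
open import Data.Empty using (⊥-elim)
open import Function using (_∘_)
open import Function.Bundles using (Equivalence)
open import Induction.WellFounded using (Acc; acc)
open import Relation.Nullary using (¬_; Dec; yes; no; ¬?)
open import Relation.Nullary.Decidable using (T?; _×-dec_; decidable-stable)
open import Relation.Unary using (Decidable)
open import Relation.Binary.Definitions using (tri<; tri≈; tri>)
open import Relation.Binary.PropositionalEquality
  using (_≡_; _≢_; refl; sym; trans; cong; cong₂; subst; subst₂; module ≡-Reasoning)

2*-≡-+ : ∀ w → 2 * w ≡ w + w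
2*-≡-+ w = cong (w +_) (+-identityʳ w)

-- Counting

count : (ℕ → Bool) → ℕ → ℕ
count p zero    = 0
count p (suc n) = if p n then suc (count p n) else count p n

length-filterᵇ-upTo : ∀ p n → length (filterᵇ p (upTo n)) ≡ count p n
length-filterᵇ-upTo p zero    = refl
length-filterᵇ-upTo p (suc n) = begin
  length (filterᵇ p (upTo (suc n)))                     ≡⟨ cong (length ∘ filterᵇ p) (sym (upTo-∷ʳ n)) ⟩
  length (filterᵇ p (upTo n ++ [ n ]))                  ≡⟨ cong length (filter-++ (T? ∘ p) (upTo n) [ n ]) ⟩
  length (filterᵇ p (upTo n) ++ filterᵇ p [ n ])        ≡⟨ length-++ (filterᵇ p (upTo n)) ⟩
  length (filterᵇ p (upTo n)) + length (filterᵇ p [ n ]) ≡⟨ cong (_+ length (filterᵇ p [ n ])) (length-filterᵇ-upTo p n) ⟩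
  count p n + length (filterᵇ p [ n ])                  ≡⟨ last n ⟩
  count p (suc n)                                       ∎
  where
  open ≡-Reasoning
  last : ∀ n → count p n + length (filterᵇ p [ n ]) ≡ count p (suc n)
  last n with p n
  ... | true  = +-comm (count p n) 1
  ... | false = +-identityʳ (count p n)

count-cong : ∀ {p q} n → (∀ x → x < n → p x ≡ q x) → count p n ≡ count q n
count-cong zero    eq = refl
count-cong {p} {q} (suc n) eq
  rewrite eq n ≤-refl | count-cong n (λ x x<n → eq x (m<n⇒m<1+n x<n)) = refl

count-zero : ∀ {p} n → (∀ x → x < n → p x ≡ false) → count p n ≡ 0
count-zero zero    none = refl
count-zero (suc n) none rewrite none n ≤-refl = count-zero n (λ x x<n → none x (m<n⇒m<1+n x<n))

count-suc-shift : ∀ p n → count p (suc n) ≡ count (p ∘ suc) n + count p 1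
count-suc-shift p zero = refl
count-suc-shift p (suc n) with p (suc n)
... | true  = cong suc (count-suc-shift p n)
... | false = count-suc-shift p n

count-beyond : ∀ {p} m n → m ≤ n → (∀ x → m ≤ x → p x ≡ false) → count p n ≡ count p m
count-beyond m zero    z≤n none = refl
count-beyond m (suc n) m≤1+n none with m ≟ suc n
... | yes refl = refl
... | no m≢1+n rewrite none n (m<1+n⇒m≤n (≤∧≢⇒< m≤1+n m≢1+n)) =
  count-beyond m n (m<1+n⇒m≤n (≤∧≢⇒< m≤1+n m≢1+n)) none

count-flip : ∀ {p q} c n → c < n → p c ≡ true → q c ≡ false → (∀ x → x ≢ c → p x ≡ q x) →
             count p n ≡ suc (count q n)
count-flip {p} {q} c (suc n) c<1+n pc qc same with c ≟ n
... | yes refl rewrite pc | qc = cong suc (count-cong c (λ x x<c → same x (<⇒≢ x<c)))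
... | no c≢n rewrite same n (c≢n ∘ sym) with q n
...   | true  = cong suc (count-flip c n (≤∧≢⇒< (m<1+n⇒m≤n c<1+n) c≢n) pc qc same)
...   | false = count-flip c n (≤∧≢⇒< (m<1+n⇒m≤n c<1+n) c≢n) pc qc same

count-complement : ∀ p n → count p n + count (not ∘ p) n ≡ n
count-complement p zero = refl
count-complement p (suc n) with p n
... | true  = cong suc (count-complement p n)
... | false = trans (+-suc (count p n) _) (cong suc (count-complement p n))

count-∨ : ∀ p q n → count (λ x → p x ∨ q x) n ≤ count p n + count q n
count-∨ p q zero = z≤n
count-∨ p q (suc n) with p n | q n
... | true  | true  = s≤s (≤-trans (count-∨ p q n) (+-monoʳ-≤ (count p n) (n≤1+n _)))
... | true  | false = s≤s (count-∨ p q n)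
... | false | true  = ≤-trans (s≤s (count-∨ p q n)) (≤-reflexive (sym (+-suc (count p n) _)))
... | false | false = count-∨ p q n

count-≤1 : ∀ {p} n → (∀ x y → x < n → y < n → p x ≡ true → p y ≡ true → x ≡ y) → count p n ≤ 1
count-≤1 zero unique = z≤n
count-≤1 {p} (suc n) unique with p n in pn
... | true  = s≤s (≤-reflexive (count-zero n none))
  where
  none : ∀ x → x < n → p x ≡ false
  none x x<n with p x in px
  ... | true  = ⊥-elim (<⇒≢ x<n (unique x n (m<n⇒m<1+n x<n) ≤-refl px pn))
  ... | false = refl
... | false = count-≤1 n (λ x y x<n y<n → unique x y (m<n⇒m<1+n x<n) (m<n⇒m<1+n y<n))

count-snoc : ∀ p n → count p n + (if p n then 1 else 0) ≡ count p (suc n)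
count-snoc p n with p n
... | true  = +-comm (count p n) 1
... | false = +-identityʳ (count p n)

count-reflect : ∀ p n → count (λ x → p (n ∸ x)) (suc n) ≡ count p (suc n)
count-reflect p zero = refl
count-reflect p (suc n) = begin
  count (λ x → p (suc n ∸ x)) (suc (suc n))             ≡⟨ count-suc-shift (λ x → p (suc n ∸ x)) (suc n) ⟩
  count (λ x → p (n ∸ x)) (suc n) + (if p (suc n) then 1 else 0)
                                                        ≡⟨ cong (_+ (if p (suc n) then 1 else 0)) (count-reflect p n) ⟩
  count p (suc n) + (if p (suc n) then 1 else 0)        ≡⟨ count-snoc p (suc n) ⟩
  count p (suc (suc n))                                 ∎
  where open ≡-Reasoning

count-interval : ∀ {p} a k → (∀ x → x < a → p x ≡ false) → (∀ x → a ≤ x → x < k + a → p x ≡ true) →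
                 count p (k + a) ≡ k
count-interval a zero    below inside = count-zero a below
count-interval a (suc k) below inside
  rewrite inside (k + a) (m≤n+m a k) ≤-refl =
  cong suc (count-interval a k below (λ x a≤x x<k+a → inside x a≤x (m<n⇒m<1+n x<k+a)))

count-witness : ∀ {p} n → 0 < count p n → ∃ λ x → x < n × p x ≡ true
count-witness {p} (suc n) pos with p n in pn
... | true  = n , ≤-refl , pn
... | false with count-witness n pos
...   | x , x<n , px = x , m<n⇒m<1+n x<n , px

-- Subsets of ℕ

∈ᵇ⇒¬∉ᵇ : ∀ {b} → b ≡ true → ¬ b ≡ false
∈ᵇ⇒¬∉ᵇ = not-¬

¬∈ᵇ⇒∉ᵇ : ∀ {b} → ¬ b ≡ true → b ≡ false
¬∈ᵇ⇒∉ᵇ = ¬-not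

¬∉ᵇ⇒∈ᵇ : ∀ {b} → ¬ b ≡ false → b ≡ true
¬∉ᵇ⇒∈ᵇ = ¬-not

∈ᵇ-or-∉ᵇ : ∀ P x → x ∈ᵇ P ⊎ x ∉ᵇ P
∈ᵇ-or-∉ᵇ P x with P x
... | true  = inj₁ refl
... | false = inj₂ refl

≡ᵇ-≡ : ∀ x y → (x ≡ᵇ y) ≡ true → x ≡ y
≡ᵇ-≡ x y e = ≡ᵇ⇒≡ x y (Equivalence.from T-≡ e)

≢-≡ᵇ : ∀ x y → x ≢ y → (x ≡ᵇ y) ≡ false
≢-≡ᵇ x y x≢y = ¬-not (x≢y ∘ ≡ᵇ-≡ x y)

≡ᵇ-refl : ∀ x → (x ≡ᵇ x) ≡ true
≡ᵇ-refl x = Equivalence.to T-≡ (≡⇒≡ᵇ x x refl)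

insert-≢ : ∀ {x h} P → x ≢ h → insert P h x ≡ P x
insert-≢ {x} {h} P x≢h rewrite ≢-≡ᵇ x h x≢h = ∨-identityʳ (P x)

insert-self : ∀ P h → h ∈ᵇ insert P h
insert-self P h rewrite ≡ᵇ-refl h with P h
... | true  = refl
... | false = refl

insert⁺ : ∀ {x} P h → x ∈ᵇ P → x ∈ᵇ insert P h
insert⁺ P h x∈P rewrite x∈P = refl

insert⁻ : ∀ P h x → x ∈ᵇ insert P h → x ∈ᵇ P ⊎ x ≡ h
insert⁻ P h x x∈ with x ≟ h
... | yes x≡h = inj₂ x≡h
... | no  x≢h = inj₁ (trans (sym (insert-≢ P x≢h)) x∈)

insert-∉ᵇ : ∀ {x} P h → x ∉ᵇ P → x ≢ h → x ∉ᵇ insert P h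
insert-∉ᵇ P h x∉P x≢h = trans (insert-≢ P x≢h) x∉P

remove-≢ : ∀ {x y} P → x ≢ y → remove P y x ≡ P x
remove-≢ {x} {y} P x≢y rewrite ≢-≡ᵇ x y x≢y = ∧-identityʳ (P x)

remove-self : ∀ P y → y ∉ᵇ remove P y
remove-self P y rewrite ≡ᵇ-refl y with P y
... | true  = refl
... | false = refl

remove⁺ : ∀ {x} P y → x ∈ᵇ P → x ≢ y → x ∈ᵇ remove P y
remove⁺ P y x∈P x≢y = trans (remove-≢ P x≢y) x∈P

remove⁻ : ∀ P y x → x ∈ᵇ remove P y → x ∈ᵇ P × x ≢ y
remove⁻ P y x x∈ with x ≟ y
... | yes refl = ⊥-elim (∈ᵇ⇒¬∉ᵇ x∈ (remove-self P x))
... | no  x≢y  = trans (sym (remove-≢ P x≢y)) x∈ , x≢y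

remove-∉ᵇ : ∀ {x} P y → x ∉ᵇ P → x ∉ᵇ remove P y
remove-∉ᵇ P y x∉P rewrite x∉P = refl

≐-sym : ∀ {P Q} → P ≐ Q → Q ≐ P
≐-sym P≐Q x = sym (P≐Q x)

≐-trans : ∀ {P Q R} → P ≐ Q → Q ≐ R → P ≐ R
≐-trans P≐Q Q≐R x = trans (P≐Q x) (Q≐R x)

insert-cong : ∀ {P Q} h → P ≐ Q → insert P h ≐ insert Q h
insert-cong h P≐Q x = cong (_∨ (x ≡ᵇ h)) (P≐Q x)

remove-cong : ∀ {P Q} y → P ≐ Q → remove P y ≐ remove Q y
remove-cong y P≐Q x = cong (_∧ not (x ≡ᵇ y)) (P≐Q x)

insert-remove : ∀ P x → x ∈ᵇ P → insert (remove P x) x ≐ P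
insert-remove P x x∈P z with z ≟ x
... | yes refl = trans (insert-self (remove P z) z) (sym x∈P)
... | no  z≢x  = trans (insert-≢ (remove P x) z≢x) (remove-≢ P z≢x)

remove-insert-swap : ∀ {P Q} h y → h ∉ᵇ P → y ∈ᵇ P → h ≢ y →
                     Q ≐ remove (insert P h) y → P ≐ remove (insert Q y) h
remove-insert-swap {P} {Q} h y h∉P y∈P h≢y Q≐ z with z ≟ h | z ≟ y
... | yes refl | _        = trans h∉P (sym (remove-self (insert Q y) z))
... | no  z≢h  | yes refl = trans y∈P (sym (remove⁺ (insert Q y) h (insert-self Q z) z≢h))
... | no  z≢h  | no  z≢y  = sym (begin
  remove (insert Q y) h z ≡⟨ remove-≢ (insert Q y) z≢h ⟩
  insert Q y z            ≡⟨ insert-≢ Q z≢y ⟩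
  Q z                     ≡⟨ Q≐ z ⟩
  remove (insert P h) y z ≡⟨ remove-≢ (insert P h) z≢y ⟩
  insert P h z            ≡⟨ insert-≢ P z≢h ⟩
  P z                     ∎)
  where open ≡-Reasoning

IsSpecialGap-cong : ∀ {P Q h} → P ≐ Q → IsSpecialGap P h → IsSpecialGap Q h
IsSpecialGap-cong P≐Q (h∉P , 2h∈P , h+s∈P) =
  trans (sym (P≐Q _)) h∉P , trans (sym (P≐Q _)) 2h∈P ,
  λ s s∈Q s≢0 → trans (sym (P≐Q _)) (h+s∈P s (trans (P≐Q s) s∈Q) s≢0)

IsMinGen-cong : ∀ {P Q y} → P ≐ Q → IsMinGen P y → IsMinGen Q y
IsMinGen-cong P≐Q (y∈P , y≢0 , irreducible) =
  trans (sym (P≐Q _)) y∈P , y≢0 ,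
  λ a b a∈Q b∈Q → irreducible a b (trans (P≐Q a) a∈Q) (trans (P≐Q b) b∈Q)

-- Frobenius number, multiplicity, genus

HasFrobenius : BSet → ℕ → Set
HasFrobenius P F = F ∉ᵇ P × (∀ z → F < z → z ∈ᵇ P)

HasFrobenius⇒gap≤ : ∀ {P F x} → HasFrobenius P F → x ∉ᵇ P → x ≤ F
HasFrobenius⇒gap≤ {x = x} (_ , above) x∉P with x ≤? _
... | yes x≤F = x≤F
... | no  x≰F = ⊥-elim (∈ᵇ⇒¬∉ᵇ (above x (≰⇒> x≰F)) x∉P)

module _ (S : NumSemigroup) where

  gap≢0 : ∀ {x} → x ∉ᵇ mem S → x ≢ 0
  gap≢0 x∉S refl = ∈ᵇ⇒¬∉ᵇ (has0 S) x∉S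

  gap<bound : ∀ {x} → x ∉ᵇ mem S → x < bound S
  gap<bound {x} x∉S with x <? bound S
  ... | yes x<b = x<b
  ... | no  x≮b = ⊥-elim (∈ᵇ⇒¬∉ᵇ (cofinite S x (≮⇒≥ x≮b)) x∉S)

  private
    gap∈gaps : ∀ {x} → x ∉ᵇ mem S → x ∈ gaps S
    gap∈gaps x∉S = ∈-filter⁺ (T? ∘ (not ∘ mem S)) (∈-upTo⁺ (gap<bound x∉S)) (Equivalence.from T-not-≡ x∉S)

    ∈gaps⇒gap : ∀ {x} → x ∈ gaps S → x ∉ᵇ mem S
    ∈gaps⇒gap x∈ = Equivalence.to T-not-≡ (proj₂ (∈-filter⁻ (T? ∘ (not ∘ mem S)) {xs = upTo (bound S)} x∈))

  gap≤frob : ∀ {x} → x ∉ᵇ mem S → x ≤ frob S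
  gap≤frob x∉S = foldr-preservesᵒ ≤-⊔ 0 (gaps S) (inj₂ (Any.map (λ { refl → ≤-refl }) (gap∈gaps x∉S)))
    where
    ≤-⊔ : ∀ a b → _ ≤ a ⊎ _ ≤ b → _ ≤ a ⊔ b
    ≤-⊔ a b (inj₁ x≤a) = ≤-trans x≤a (m≤m⊔n a b)
    ≤-⊔ a b (inj₂ x≤b) = ≤-trans x≤b (m≤n⊔m a b)

  frob-gap : ∀ {x} → x ∉ᵇ mem S → frob S ∉ᵇ mem S
  frob-gap {x} x∉S with foldr-selective ⊔-sel 0 (gaps S)
  ... | inj₂ frob∈gaps = ∈gaps⇒gap frob∈gaps
  ... | inj₁ frob≡0    = ⊥-elim (gap≢0 x∉S (n≤0⇒n≡0 (subst (x ≤_) frob≡0 (gap≤frob x∉S))))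

  frob-hasFrobenius : ∀ {x} → x ∉ᵇ mem S → HasFrobenius (mem S) (frob S)
  frob-hasFrobenius x∉S = frob-gap x∉S , above
    where
    above : ∀ z → frob S < z → z ∈ᵇ mem S
    above z frob<z with ∈ᵇ-or-∉ᵇ (mem S) z
    ... | inj₁ z∈S = z∈S
    ... | inj₂ z∉S = ⊥-elim (<⇒≱ frob<z (gap≤frob z∉S))

  frob-unique : ∀ {F} → HasFrobenius (mem S) F → frob S ≡ F
  frob-unique frobF@(F∉S , _) =
    ≤-antisym (HasFrobenius⇒gap≤ frobF (frob-gap F∉S)) (gap≤frob F∉S)

findFrom-spec : ∀ P x k → (k + x) ∈ᵇ P →
  findFrom P x k ∈ᵇ P × x ≤ findFrom P x k × (∀ z → x ≤ z → z < findFrom P x k → z ∉ᵇ P)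
findFrom-spec P x zero    x∈P = x∈P , ≤-refl , λ z x≤z z<x → ⊥-elim (<⇒≱ z<x x≤z)
findFrom-spec P x (suc k) k+x∈P with P x in x∈?P
... | true  = x∈?P , ≤-refl , λ z x≤z z<x → ⊥-elim (<⇒≱ z<x x≤z)
... | false with findFrom-spec P (suc x) k (subst (_∈ᵇ P) (sym (+-suc k x)) k+x∈P)
...   | found , 1+x≤found , before = found , ≤-trans (n≤1+n x) 1+x≤found , before′
  where
  before′ : ∀ z → x ≤ z → z < findFrom P (suc x) k → z ∉ᵇ P
  before′ z x≤z z<found with x ≟ z
  ... | yes refl = x∈?P
  ... | no  x≢z  = before z (≤∧≢⇒< x≤z x≢z) z<found

module _ (S : NumSemigroup) where

  private
    mult-spec = findFrom-spec (mem S) 1 (bound S) (cofinite S _ (m≤m+n (bound S) 1))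

  mult∈ : mult S ∈ᵇ mem S
  mult∈ = proj₁ mult-spec

  mult>0 : 0 < mult S
  mult>0 = proj₁ (proj₂ mult-spec)

  mult-minimal : ∀ z → 0 < z → z < mult S → z ∉ᵇ mem S
  mult-minimal = proj₂ (proj₂ mult-spec)

  mult≤ : ∀ {z} → 0 < z → z ∈ᵇ mem S → mult S ≤ z
  mult≤ {z} z>0 z∈S with mult S ≤? z
  ... | yes m≤z = m≤z
  ... | no  m≰z = ⊥-elim (∈ᵇ⇒¬∉ᵇ z∈S (mult-minimal z z>0 (≰⇒> m≰z)))

  mult-unique : ∀ {m} → m ∈ᵇ mem S → 0 < m → (∀ z → 0 < z → z < m → z ∉ᵇ mem S) → mult S ≡ m
  mult-unique {m} m∈S m>0 below = ≤-antisym (mult≤ m>0 m∈S) m≤mult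
    where
    m≤mult : m ≤ mult S
    m≤mult with m ≤? mult S
    ... | yes m≤ = m≤
    ... | no  m≰ = ⊥-elim (∈ᵇ⇒¬∉ᵇ mult∈ (below (mult S) mult>0 (≰⇒> m≰)))

  genus-count : ∀ M → (∀ z → M ≤ z → z ∈ᵇ mem S) → genus S ≡ count (not ∘ mem S) M
  genus-count M above = begin
    genus S                                ≡⟨ length-filterᵇ-upTo (not ∘ mem S) (bound S) ⟩
    count (not ∘ mem S) (bound S)          ≡⟨ count-beyond (bound S) (M ⊔ bound S) (m≤n⊔m M _) (λ z b≤z → cong not (cofinite S z b≤z)) ⟨
    count (not ∘ mem S) (M ⊔ bound S)      ≡⟨ count-beyond M (M ⊔ bound S) (m≤m⊔n M _) (λ z M≤z → cong not (above z M≤z)) ⟩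
    count (not ∘ mem S) M                  ∎
    where open ≡-Reasoning

  nS-count : ∀ {x} → x ∉ᵇ mem S → nS S ≡ count (mem S) (suc (frob S))
  nS-count x∉S rewrite frob-gap S x∉S = length-filterᵇ-upTo (mem S) (frob S)

  genus+nS : ∀ {x} → x ∉ᵇ mem S → genus S + nS S ≡ suc (frob S)
  genus+nS x∉S = begin
    genus S + nS S                                       ≡⟨ cong₂ _+_ (genus-count (suc F) above) (nS-count x∉S) ⟩
    count (not ∘ mem S) (suc F) + count (mem S) (suc F)  ≡⟨ +-comm _ (count (mem S) (suc F)) ⟩
    count (mem S) (suc F) + count (not ∘ mem S) (suc F)  ≡⟨ count-complement (mem S) (suc F) ⟩
    suc F                                                ∎
    where
    open ≡-Reasoning
    F = frob S
    above : ∀ z → suc F ≤ z → z ∈ᵇ mem S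
    above = proj₂ (frob-hasFrobenius S x∉S)

frob-cong : ∀ {S S′ x} → mem S ≐ mem S′ → x ∉ᵇ mem S → frob S ≡ frob S′
frob-cong {S} {S′} S≐S′ x∉S =
  sym (frob-unique S′ (trans (sym (S≐S′ _)) F∉S , λ z F<z → trans (sym (S≐S′ z)) (above z F<z)))
  where
  F∉S = proj₁ (frob-hasFrobenius S x∉S)
  above = proj₂ (frob-hasFrobenius S x∉S)

mult-cong : ∀ {S S′} → mem S ≐ mem S′ → mult S ≡ mult S′
mult-cong {S} {S′} S≐S′ =
  sym (mult-unique S′ (trans (sym (S≐S′ _)) (mult∈ S)) (mult>0 S)
         (λ z z>0 z<m → trans (sym (S≐S′ z)) (mult-minimal S z z>0 z<m)))

-- Deciding special gaps

greatest : ∀ {P : ℕ → Set} → Decidable P → ∀ B {a} → P a → (∀ x → P x → x ≤ B) → ∃ (IsMaxOf P)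
greatest P? B Pa bounded with P? B
... | yes PB = B , PB , bounded
greatest {P} P? zero    {a} Pa bounded | no ¬PB = ⊥-elim (¬PB (subst P (n≤0⇒n≡0 (bounded a Pa)) Pa))
greatest     P? (suc B)     Pa bounded | no ¬PB = greatest P? B Pa bounded′
  where
  bounded′ : ∀ x → _ → x ≤ B
  bounded′ x Px = m<1+n⇒m≤n (≤∧≢⇒< (bounded x Px) (λ { refl → ¬PB Px }))

module _ (S : NumSemigroup) where

  specialGap-or-obstruction : ∀ {w} → w ∉ᵇ mem S → (2 * w) ∈ᵇ mem S →
    IsSpecialGap (mem S) w ⊎ ∃ λ s → s ∈ᵇ mem S × s ≢ 0 × (w + s) ∉ᵇ mem S
  specialGap-or-obstruction {w} w∉S 2w∈S with anyUpTo? obstruction? (bound S)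
    where
    obstruction? : Decidable (λ s → s ∈ᵇ mem S × s ≢ 0 × (w + s) ∉ᵇ mem S)
    obstruction? s = (mem S s ≟ᵇ true) ×-dec (¬? (s ≟ 0)) ×-dec (mem S (w + s) ≟ᵇ false)
  ... | yes (s , _ , obstruction) = inj₂ (s , obstruction)
  ... | no  none = inj₁ (w∉S , 2w∈S , w+s∈S)
    where
    w+s∈S : ∀ s → s ∈ᵇ mem S → s ≢ 0 → (w + s) ∈ᵇ mem S
    w+s∈S s s∈S s≢0 with s <? bound S
    ... | yes s<b = ¬∉ᵇ⇒∈ᵇ (λ w+s∉S → none (s , s<b , s∈S , s≢0 , w+s∉S))
    ... | no  s≮b = cofinite S (w + s) (≤-trans (≮⇒≥ s≮b) (m≤n+m s w))

  isSpecialGap? : Decidable (IsSpecialGap (mem S))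
  isSpecialGap? w with mem S w ≟ᵇ false | mem S (2 * w) ≟ᵇ true
  ... | no  w∈S | _       = no (w∈S ∘ proj₁)
  ... | yes _   | no  2w∉S = no (2w∉S ∘ proj₁ ∘ proj₂)
  ... | yes w∉S | yes 2w∈S with specialGap-or-obstruction w∉S 2w∈S
  ...   | inj₁ special = yes special
  ...   | inj₂ (s , s∈S , s≢0 , w+s∉S) = no (λ (_ , _ , w+S⊆S) → ∈ᵇ⇒¬∉ᵇ (w+S⊆S s s∈S s≢0) w+s∉S)

  anySpecialGap? : ∀ {Q : ℕ → Set} → Decidable Q → Dec (∃ λ h → IsSpecialGap (mem S) h × Q h)
  anySpecialGap? Q? with anyUpTo? (λ h → isSpecialGap? h ×-dec Q? h) (bound S)
  ... | yes (h , _ , found) = yes (h , found)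
  ... | no  none = no (λ (h , special , Qh) → none (h , gap<bound S (proj₁ special) , special , Qh))

  greatestSpecialGap : ∀ {Q : ℕ → Set} → Decidable Q → ∀ {k} → IsSpecialGap (mem S) k → Q k →
                       ∃ (IsMaxOf (λ x → IsSpecialGap (mem S) x × Q x))
  greatestSpecialGap Q? special Qk =
    greatest (λ h → isSpecialGap? h ×-dec Q? h) (bound S) (special , Qk)
      (λ x (special , _) → <⇒≤ (gap<bound S (proj₁ special)))

-- Special gaps above F/2

module HalfFrobenius (S : NumSemigroup) {F} (frobF : HasFrobenius (mem S) F) where

  private
    above : ∀ z → F < z → z ∈ᵇ mem S
    above = proj₂ frobF

  gap-pair⇒< : ∀ {w} → w ∉ᵇ mem S → (F ∸ w) ∉ᵇ mem S → w < F
  gap-pair⇒< {w} w∉S F∸w∉S = ≤∧≢⇒< (HasFrobenius⇒gap≤ frobF w∉S) w≢F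
    where
    w≢F : w ≢ F
    w≢F refl = ∈ᵇ⇒¬∉ᵇ (subst (_∈ᵇ mem S) (sym (n∸n≡0 w)) (has0 S)) F∸w∉S

  -- As long as w is not special, some w + s (s ∈ S) is a larger gap, and F ∸ (w + s) stays a gap
  -- because adding s to it gives the gap F ∸ w.
  climb : ∀ w → Acc _<_ (F ∸ w) → w ∉ᵇ mem S → (F ∸ w) ∉ᵇ mem S → F < 2 * w →
          ∃ λ v → IsSpecialGap (mem S) v × v ≢ F × w ≤ v
  climb w (acc smaller) w∉S F∸w∉S F<2w
    with specialGap-or-obstruction S w∉S (above (2 * w) F<2w)
  ... | inj₁ special = w , special , <⇒≢ w<F , ≤-refl
    where w<F = gap-pair⇒< w∉S F∸w∉S
  ... | inj₂ (s , s∈S , s≢0 , w+s∉S) =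
    let v , special , v≢F , w+s≤v = climb (w + s) (smaller F∸z<F∸w) w+s∉S F∸z∉S F<2z
    in  v , special , v≢F , ≤-trans (m≤m+n w s) w+s≤v
    where
    z = w + s
    z≤F : z ≤ F
    z≤F = HasFrobenius⇒gap≤ frobF w+s∉S
    F∸z∉S : (F ∸ z) ∉ᵇ mem S
    F∸z∉S = ¬∈ᵇ⇒∉ᵇ λ F∸z∈S → ∈ᵇ⇒¬∉ᵇ (subst (_∈ᵇ mem S) F∸z+s≡F∸w (closed S _ s F∸z∈S s∈S)) F∸w∉S
      where
      F∸z+s≡F∸w : (F ∸ z) + s ≡ F ∸ w
      F∸z+s≡F∸w = trans (cong (_+ s) (sym (∸-+-assoc F w s)))
                        (m∸n+n≡m (m+n≤o⇒m≤o∸n s (subst (_≤ F) (+-comm w s) z≤F)))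
    F<2z : F < 2 * z
    F<2z = <-≤-trans F<2w (*-monoʳ-≤ 2 (m≤m+n w s))
    F∸z<F∸w : F ∸ z < F ∸ w
    F∸z<F∸w = ∸-monoʳ-< (m<m+n w (n≢0⇒n>0 s≢0)) z≤F

  specialGap-above-half : ∀ {w} → w ∉ᵇ mem S → (F ∸ w) ∉ᵇ mem S → 2 * w ≢ F →
                          ∃ λ v → IsSpecialGap (mem S) v × v ≢ F × w ≤ v × F < 2 * v
  specialGap-above-half {w} w∉S F∸w∉S 2w≢F with <-cmp (2 * w) F
  ... | tri≈ _ 2w≡F _ = ⊥-elim (2w≢F 2w≡F)
  ... | tri> _ _ F<2w =
    let v , special , v≢F , w≤v = climb w (<-wellFounded _) w∉S F∸w∉S F<2w
    in  v , special , v≢F , w≤v , <-≤-trans F<2w (*-monoʳ-≤ 2 w≤v)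
  ... | tri< 2w<F _ _ =
    let v , special , v≢F , w′≤v = climb w′ (<-wellFounded _) F∸w∉S F∸w′∉S F<2w′
    in  v , special , v≢F , ≤-trans (<⇒≤ w<w′) w′≤v , <-≤-trans F<2w′ (*-monoʳ-≤ 2 w′≤v)
    where
    w′ = F ∸ w
    w≤F = <⇒≤ (gap-pair⇒< w∉S F∸w∉S)
    F∸w′∉S : (F ∸ w′) ∉ᵇ mem S
    F∸w′∉S = subst (_∉ᵇ mem S) (sym (m∸[m∸n]≡n w≤F)) w∉S
    w<w′ : w < w′
    w<w′ = m+n≤o⇒m≤o∸n (suc w) (subst (_< F) (2*-≡-+ w) 2w<F)
    F<2w′ : F < 2 * w′
    F<2w′ = begin-strict
      F        ≡⟨ m+[n∸m]≡n w≤F ⟨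
      w + w′   <⟨ +-monoˡ-< w′ w<w′ ⟩
      w′ + w′  ≡⟨ 2*-≡-+ w′ ⟨
      2 * w′   ∎
      where open ≤-Reasoning

  greatestSpecialGap-above-half : ∀ {k} → IsMaxOf (λ x → IsSpecialGap (mem S) x × x ≢ F) k → F < 2 * k
  greatestSpecialGap-above-half {k} (((k∉S , 2k∈S , k+S⊆S) , k≢F) , greatest) =
    let v , v-special , v≢F , _ , F<2v = specialGap-above-half w∉S F∸w∉S 2w≢F
    in  <-≤-trans F<2v (*-monoʳ-≤ 2 (greatest v (v-special , v≢F)))
    where
    k<F = ≤∧≢⇒< (HasFrobenius⇒gap≤ frobF k∉S) k≢F
    k≤F = <⇒≤ k<F
    w = F ∸ k
    k+w≡F : k + w ≡ F
    k+w≡F = m+[n∸m]≡n k≤F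
    w∉S : w ∉ᵇ mem S
    w∉S = ¬∈ᵇ⇒∉ᵇ λ w∈S →
      ∈ᵇ⇒¬∉ᵇ (subst (_∈ᵇ mem S) k+w≡F (k+S⊆S w w∈S (<⇒≢ (m<n⇒0<n∸m k<F) ∘ sym))) (proj₁ frobF)
    F∸w∉S : (F ∸ w) ∉ᵇ mem S
    F∸w∉S = subst (_∉ᵇ mem S) (sym (m∸[m∸n]≡n k≤F)) k∉S
    2w≢F : 2 * w ≢ F
    2w≢F 2w≡F = ∈ᵇ⇒¬∉ᵇ (subst (_∈ᵇ mem S) 2k≡F 2k∈S) (proj₁ frobF)
      where
      w≡k : w ≡ k
      w≡k = +-cancelʳ-≡ w w k (trans (sym (2*-≡-+ w)) (trans 2w≡F (sym k+w≡F)))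
      2k≡F : 2 * k ≡ F
      2k≡F = trans (cong (2 *_) (sym w≡k)) 2w≡F

-- Irreducibility

addSpecialGap : (S : NumSemigroup) (h : ℕ) → IsSpecialGap (mem S) h → NumSemigroup
addSpecialGap S h (_ , 2h∈S , h+S⊆S) = record
  { mem      = insert (mem S) h
  ; bound    = bound S
  ; has0     = insert⁺ (mem S) h (has0 S)
  ; closed   = closed′
  ; cofinite = λ x b≤x → insert⁺ (mem S) h (cofinite S x b≤x)
  }
  where
  h+x∈ : ∀ x → x ∈ᵇ insert (mem S) h → (h + x) ∈ᵇ insert (mem S) h
  h+x∈ x x∈ with insert⁻ (mem S) h x x∈ | x ≟ 0
  ... | _          | yes refl = subst (_∈ᵇ insert (mem S) h) (sym (+-identityʳ h)) (insert-self (mem S) h)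
  ... | inj₁ x∈S   | no  x≢0  = insert⁺ (mem S) h (h+S⊆S x x∈S x≢0)
  ... | inj₂ refl  | no  _    = insert⁺ (mem S) h (subst (_∈ᵇ mem S) (2*-≡-+ h) 2h∈S)
  closed′ : ∀ x y → x ∈ᵇ insert (mem S) h → y ∈ᵇ insert (mem S) h → (x + y) ∈ᵇ insert (mem S) h
  closed′ x y x∈ y∈ with insert⁻ (mem S) h x x∈ | insert⁻ (mem S) h y y∈
  ... | inj₁ x∈S  | inj₁ y∈S  = insert⁺ (mem S) h (closed S x y x∈S y∈S)
  ... | inj₂ refl | _         = h+x∈ y y∈
  ... | inj₁ _    | inj₂ refl = subst (_∈ᵇ insert (mem S) h) (+-comm h x) (h+x∈ x x∈)

removeMinGen : (S : NumSemigroup) (y : ℕ) → IsMinGen (mem S) y → NumSemigroup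
removeMinGen S y (_ , y≢0 , indecomposable) = record
  { mem      = remove (mem S) y
  ; bound    = suc y + bound S
  ; has0     = remove⁺ (mem S) y (has0 S) (y≢0 ∘ sym)
  ; closed   = closed′
  ; cofinite = λ x b≤x → remove⁺ (mem S) y (cofinite S x (≤-trans (m≤n+m (bound S) (suc y)) b≤x))
                           (λ { refl → <⇒≱ (m≤m+n (suc x) (bound S)) b≤x })
  }
  where
  closed′ : ∀ a b → a ∈ᵇ remove (mem S) y → b ∈ᵇ remove (mem S) y → (a + b) ∈ᵇ remove (mem S) y
  closed′ a b a∈ b∈ with remove⁻ (mem S) y a a∈ | remove⁻ (mem S) y b b∈
  ... | a∈S , a≢y | b∈S , b≢y = remove⁺ (mem S) y (closed S a b a∈S b∈S) a+b≢y
    where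
    a+b≢y : a + b ≢ y
    a+b≢y with a ≟ 0 | b ≟ 0
    ... | yes refl | _        = b≢y
    ... | no  _    | yes refl = a≢y ∘ trans (sym (+-identityʳ a))
    ... | no  a≢0  | no  b≢0  = indecomposable a b a∈S b∈S a≢0 b≢0

frobenius-isSpecialGap : ∀ (S : NumSemigroup) {F} → HasFrobenius (mem S) F → IsSpecialGap (mem S) F
frobenius-isSpecialGap S {F} (F∉S , above) =
  F∉S , above (2 * F) (subst (F <_) (sym (2*-≡-+ F)) (m<m+n F (n≢0⇒n>0 (gap≢0 S F∉S)))) ,
  λ s _ s≢0 → above (F + s) (m<m+n F (n≢0⇒n>0 s≢0))

otherSpecialGap⇒¬Irreducible : ∀ (S : NumSemigroup) {F x} → HasFrobenius (mem S) F →
                               IsSpecialGap (mem S) x → x ≢ F → ¬ Irreducible (mem S)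
otherSpecialGap⇒¬Irreducible S {F} {x} frobF x-special x≢F irreducible =
  irreducible (S₁ , S₂ , extends x-special , extends (frobenius-isSpecialGap S frobF) , S≡S₁∩S₂)
  where
  S₁ = addSpecialGap S x x-special
  S₂ = addSpecialGap S F (frobenius-isSpecialGap S frobF)
  extends : ∀ {h} (h-special : IsSpecialGap (mem S) h) → ProperlyContains (addSpecialGap S h h-special) (mem S)
  extends {h} (h∉S , _) = (λ _ → insert⁺ (mem S) h) , h , insert-self (mem S) h , h∉S
  S≡S₁∩S₂ : ∀ z → mem S z ≡ (mem S₁ z ∧ mem S₂ z)
  S≡S₁∩S₂ z with ∈ᵇ-or-∉ᵇ (mem S) z
  ... | inj₁ z∈S = trans z∈S (sym (cong₂ _∧_ (insert⁺ (mem S) x z∈S) (insert⁺ (mem S) F z∈S)))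
  ... | inj₂ z∉S with z ≟ x
  ...   | yes refl = trans z∉S (sym (trans (cong (mem S₁ z ∧_) (insert-∉ᵇ (mem S) F z∉S x≢F)) (∧-zeroʳ _)))
  ...   | no  z≢x  = trans z∉S (sym (cong (_∧ mem S₂ z) (insert-∉ᵇ (mem S) x z∉S z≢x)))

greatestNewElement-isSpecialGap : ∀ (S S′ : NumSemigroup) → (∀ x → x ∈ᵇ mem S → x ∈ᵇ mem S′) →
  ∀ {w} → IsMaxOf (λ z → z ∈ᵇ mem S′ × z ∉ᵇ mem S) w → IsSpecialGap (mem S) w
greatestNewElement-isSpecialGap S S′ S⊆S′ {w} ((w∈S′ , w∉S) , greatest) = w∉S , 2w∈S , w+s∈S
  where
  w>0 : 0 < w
  w>0 = n≢0⇒n>0 (gap≢0 S w∉S)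
  2w∈S : (2 * w) ∈ᵇ mem S
  2w∈S = ¬∉ᵇ⇒∈ᵇ λ 2w∉S → <⇒≱ (subst (w <_) (sym (2*-≡-+ w)) (m<m+n w w>0))
           (greatest (2 * w) (subst (_∈ᵇ mem S′) (sym (2*-≡-+ w)) (closed S′ w w w∈S′ w∈S′) , 2w∉S))
  w+s∈S : ∀ s → s ∈ᵇ mem S → s ≢ 0 → (w + s) ∈ᵇ mem S
  w+s∈S s s∈S s≢0 = ¬∉ᵇ⇒∈ᵇ λ w+s∉S → <⇒≱ (m<m+n w (n≢0⇒n>0 s≢0))
           (greatest (w + s) (closed S′ w s w∈S′ (S⊆S′ s s∈S) , w+s∉S))

onlyFrobeniusSpecial⇒Irreducible : ∀ (S : NumSemigroup) {F} → HasFrobenius (mem S) F →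
  (∀ k → IsSpecialGap (mem S) k → k ≡ F) → Irreducible (mem S)
onlyFrobeniusSpecial⇒Irreducible S {F} frobF only (S₁ , S₂ , ext₁ , ext₂ , S≡S₁∩S₂) =
  ∈ᵇ⇒¬∉ᵇ (trans (S≡S₁∩S₂ F) (cong₂ _∧_ (F∈ S₁ ext₁) (F∈ S₂ ext₂))) (proj₁ frobF)
  where
  -- the greatest element of S′ ∖ S is a special gap of S, hence it is F
  F∈ : ∀ S′ → ProperlyContains S′ (mem S) → F ∈ᵇ mem S′
  F∈ S′ (S⊆S′ , a , a∈S′ , a∉S) =
    let w , greatestNew = greatest (λ z → (mem S′ z ≟ᵇ true) ×-dec (mem S z ≟ᵇ false)) F (a∈S′ , a∉S)
                            (λ z (_ , z∉S) → HasFrobenius⇒gap≤ frobF z∉S)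
    in  subst (_∈ᵇ mem S′) (only w (greatestNewElement-isSpecialGap S S′ S⊆S′ greatestNew)) (proj₁ (proj₁ greatestNew))

¬Irreducible⇒otherSpecialGap : ∀ (S : NumSemigroup) {F} → HasFrobenius (mem S) F →
  ¬ Irreducible (mem S) → ∃ λ k → IsSpecialGap (mem S) k × k ≢ F
¬Irreducible⇒otherSpecialGap S {F} frobF reducible with anySpecialGap? S (λ k → ¬? (k ≟ F))
... | yes other = other
... | no  none  = ⊥-elim (reducible (onlyFrobeniusSpecial⇒Irreducible S frobF only))
  where
  only : ∀ k → IsSpecialGap (mem S) k → k ≡ F
  only k special with k ≟ F
  ... | yes k≡F = k≡F
  ... | no  k≢F = ⊥-elim (none (k , special , k≢F))

-- The map A

module Exchange (S S′ : NumSemigroup) {h y} (h∉S : h ∉ᵇ mem S) (y∈S : y ∈ᵇ mem S)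
                (h<F : h < frob S) (y<F : y < frob S) (S′≐ : mem S′ ≐ remove (insert (mem S) h) y) where

  private
    F = frob S
    I = insert (mem S) h
    R = remove I y
    frobS = frob-hasFrobenius S h∉S

  hasFrobenius : HasFrobenius (mem S′) F
  hasFrobenius =
    trans (S′≐ F) (remove-∉ᵇ I y (insert-∉ᵇ (mem S) h (proj₁ frobS) (<⇒≢ h<F ∘ sym))) ,
    λ z F<z → trans (S′≐ z) (remove⁺ I y (insert⁺ (mem S) h (proj₂ frobS z F<z)) (<⇒≢ (<-trans y<F F<z) ∘ sym))

  frob-preserved : frob S′ ≡ F
  frob-preserved = frob-unique S′ hasFrobenius

  genus-preserved : genus S′ ≡ genus S
  genus-preserved = begin
    genus S′                          ≡⟨ genus-count S′ (suc F) (proj₂ hasFrobenius) ⟩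
    count (not ∘ mem S′) (suc F)      ≡⟨ count-cong (suc F) (λ x _ → cong not (S′≐ x)) ⟩
    count (not ∘ R) (suc F)           ≡⟨ count-flip y (suc F) (m<n⇒m<1+n y<F) (cong not (remove-self I y))
                                           (cong not (insert⁺ (mem S) h y∈S)) (λ x x≢y → cong not (remove-≢ I x≢y)) ⟩
    suc (count (not ∘ I) (suc F))     ≡⟨ count-flip h (suc F) (m<n⇒m<1+n h<F) (cong not h∉S)
                                           (cong not (insert-self (mem S) h)) (λ x x≢h → cong not (sym (insert-≢ (mem S) x≢h))) ⟨
    count (not ∘ mem S) (suc F)       ≡⟨ genus-count S (suc F) (proj₂ frobS) ⟨
    genus S                           ∎
    where open ≡-Reasoning

  nS-preserved : nS S′ ≡ nS S
  nS-preserved = begin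
    nS S′                    ≡⟨ length-filterᵇ-upTo (mem S′) (frob S′) ⟩
    count (mem S′) (frob S′) ≡⟨ cong (count (mem S′)) frob-preserved ⟩
    count (mem S′) F         ≡⟨ count-cong F (λ x _ → S′≐ x) ⟩
    count R F                ≡⟨ suc-injective (trans (sym I-by-y) I-by-h) ⟩
    count (mem S) F          ≡⟨ length-filterᵇ-upTo (mem S) F ⟨
    nS S                     ∎
    where
    open ≡-Reasoning
    I-by-y : count I F ≡ suc (count R F)
    I-by-y = count-flip y F y<F (insert⁺ (mem S) h y∈S) (remove-self I y) (λ x x≢y → sym (remove-≢ I x≢y))
    I-by-h : count I F ≡ suc (count (mem S) F)
    I-by-h = count-flip h F h<F (insert-self (mem S) h) h∉S (λ x x≢h → insert-≢ (mem S) x≢h)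

specialGapAboveMult? : ∀ S → Dec (∃ λ h → IsSpecialGap (mem S) h × h ≢ frob S × mult S < h)
specialGapAboveMult? S = anySpecialGap? S (λ h → ¬? (h ≟ frob S) ×-dec (mult S <? h))

isSpecial? : ∀ S → Dec (IsSpecial S)
isSpecial? S = ¬? (specialGapAboveMult? S)

nonSpecial-witness : ∀ S → NonSpecial S → ∃ λ h → IsSpecialGap (mem S) h × h ≢ frob S × mult S < h
nonSpecial-witness S = decidable-stable (specialGapAboveMult? S)

nonSpecial-mult<frob : ∀ S → NonSpecial S → mult S < frob S
nonSpecial-mult<frob S nonSpecial =
  let h , (h∉S , _) , _ , m<h = nonSpecial-witness S nonSpecial
  in  <-≤-trans m<h (gap≤frob S h∉S)

insert-above-mult : ∀ S {h x} → mult S < h → x ∈ᵇ insert (mem S) h → x ≢ 0 → mult S ≤ x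
insert-above-mult S {h} {x} m<h x∈ x≢0 with insert⁻ (mem S) h x x∈
... | inj₁ x∈S = mult≤ S (n≢0⇒n>0 x≢0) x∈S
... | inj₂ refl = <⇒≤ m<h

mult-isMinGen-insert : ∀ S {h} → mult S < h → IsMinGen (insert (mem S) h) (mult S)
mult-isMinGen-insert S {h} m<h =
  insert⁺ (mem S) h (mult∈ S) , (λ m≡0 → <⇒≢ (mult>0 S) (sym m≡0)) ,
  λ a b a∈ b∈ a≢0 b≢0 a+b≡m →
    <⇒≱ (m<m+n a (n≢0⇒n>0 b≢0))
        (≤-trans (≤-reflexive a+b≡m) (insert-above-mult S m<h a∈ a≢0))

GreatestOtherSpecialGap : NumSemigroup → ℕ → Set
GreatestOtherSpecialGap S = IsMaxOf (λ x → IsSpecialGap (mem S) x × x ≢ frob S)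

greatestOtherSpecialGap>mult : ∀ S → NonSpecial S → ∀ {h} → GreatestOtherSpecialGap S h → mult S < h
greatestOtherSpecialGap>mult S nonSpecial h-greatest =
  let k , k-special , k≢F , m<k = nonSpecial-witness S nonSpecial
  in  <-≤-trans m<k (proj₂ h-greatest k (k-special , k≢F))

module AStep (S T : NumSemigroup) (nonSpecial : NonSpecial S) {h : ℕ}
             (h-greatest : GreatestOtherSpecialGap S h)
             (T≐ : mem T ≐ remove (insert (mem S) h) (mult S)) where

  h-special : IsSpecialGap (mem S) h
  h-special = proj₁ (proj₁ h-greatest)

  mult<h : mult S < h
  mult<h = greatestOtherSpecialGap>mult S nonSpecial h-greatest

  h<frob : h < frob S
  h<frob = ≤∧≢⇒< (gap≤frob S (proj₁ h-special)) (proj₂ (proj₁ h-greatest))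

  open Exchange S T (proj₁ h-special) (mult∈ S) h<frob (<-trans mult<h h<frob) T≐ public

  mult-increases : mult S < mult T
  mult-increases with remove⁻ (insert (mem S) h) (mult S) (mult T) (trans (sym (T≐ (mult T))) (mult∈ T))
  ... | mT∈ , mT≢m = ≤∧≢⇒< (insert-above-mult S mult<h mT∈ (λ mT≡0 → <⇒≢ (mult>0 T) (sym mT≡0))) (mT≢m ∘ sym)

A-exists : ∀ S → NonSpecial S → ∃ (IsA S)
A-exists S nonSpecial =
  let k , k-special , k≢F , _ = nonSpecial-witness S nonSpecial
      h , h-greatest = greatestSpecialGap S (λ x → ¬? (x ≟ frob S)) k-special k≢F
      T = removeMinGen (addSpecialGap S h (proj₁ (proj₁ h-greatest))) (mult S)
                       (mult-isMinGen-insert S (greatestOtherSpecialGap>mult S nonSpecial h-greatest))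
  in  T , h , h-greatest , λ _ → refl

A-functional : ∀ {S S′ T T′} → IsA S T → IsA S′ T′ → mem S ≐ mem S′ → mem T ≐ mem T′
A-functional {S} {S′} {T} {T′} (h , ((h-special , h≢F) , h-max) , T≐) (h′ , ((h′-special , h′≢F′) , h′-max) , T′≐) S≐S′ =
  ≐-trans T≐ (≐-trans same (≐-sym T′≐))
  where
  F≡F′ = frob-cong {S} {S′} S≐S′ (proj₁ h-special)
  h≡h′ : h ≡ h′
  h≡h′ = ≤-antisym (h′-max h (IsSpecialGap-cong S≐S′ h-special , h≢F ∘ (λ h≡F′ → trans h≡F′ (sym F≡F′))))
                   (h-max h′ (IsSpecialGap-cong (≐-sym S≐S′) h′-special , λ h′≡F → h′≢F′ (trans h′≡F F≡F′)))
  same : remove (insert (mem S) h) (mult S) ≐ remove (insert (mem S′) h′) (mult S′)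
  same rewrite h≡h′ | mult-cong {S} {S′} S≐S′ = remove-cong (mult S′) (insert-cong h′ S≐S′)

-- Special semigroups of given genus and n

AlmostOrdinary : BSet → ℕ → ℕ → Set
AlmostOrdinary P m F =
  0 ∈ᵇ P × (∀ z → 0 < z → z < m → z ∉ᵇ P) × (∀ z → m ≤ z → z < F → z ∈ᵇ P) × HasFrobenius P F

almostOrdinary-unique : ∀ {P Q m F} → AlmostOrdinary P m F → AlmostOrdinary Q m F → P ≐ Q
almostOrdinary-unique {m = m} {F} (p0 , p<m , p-mid , pF , p>F) (q0 , q<m , q-mid , qF , q>F) z
  with z ≟ 0 | z <? m | <-cmp z F
... | yes refl | _       | _             = trans p0 (sym q0)
... | no  z≢0  | yes z<m | _             = trans (p<m z (n≢0⇒n>0 z≢0) z<m) (sym (q<m z (n≢0⇒n>0 z≢0) z<m))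
... | no  _    | no  z≮m | tri< z<F _ _  = trans (p-mid z (≮⇒≥ z≮m) z<F) (sym (q-mid z (≮⇒≥ z≮m) z<F))
... | no  _    | no  _   | tri≈ _ refl _ = trans pF (sym qF)
... | no  _    | no  _   | tri> _ _ F<z  = trans (p>F z F<z) (sym (q>F z F<z))

almostOrdinary-cong : ∀ {P Q m F} → P ≐ Q → AlmostOrdinary Q m F → AlmostOrdinary P m F
almostOrdinary-cong P≐Q (q0 , q<m , q-mid , qF , q>F) =
  trans (P≐Q _) q0 , (λ z a b → trans (P≐Q z) (q<m z a b)) , (λ z a b → trans (P≐Q z) (q-mid z a b)) ,
  trans (P≐Q _) qF , (λ z a → trans (P≐Q z) (q>F z a))

module AlmostOrdinarySemigroup (S : NumSemigroup) {m F} (m>0 : 0 < m) (m<F : m < F)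
                               (shape : AlmostOrdinary (mem S) m F) where

  private
    zero∈ = proj₁ shape
    below-m = proj₁ (proj₂ shape)
    between = proj₁ (proj₂ (proj₂ shape))

  hasFrobenius : HasFrobenius (mem S) F
  hasFrobenius = proj₂ (proj₂ (proj₂ shape))

  frob≡ : frob S ≡ F
  frob≡ = frob-unique S hasFrobenius

  mult≡ : mult S ≡ m
  mult≡ = mult-unique S (between m ≤-refl m<F) m>0 below-m

  nS≡ : nS S ≡ suc (F ∸ m)
  nS≡ = begin
    nS S                                   ≡⟨ length-filterᵇ-upTo (mem S) (frob S) ⟩
    count (mem S) (frob S)                 ≡⟨ cong (count (mem S)) frob≡ ⟩
    count (mem S) F                        ≡⟨ count-flip 0 F (≤-<-trans z≤n m<F) zero∈ (remove-self (mem S) 0) (λ x x≢0 → sym (remove-≢ (mem S) x≢0)) ⟩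
    suc (count (remove (mem S) 0) F)       ≡⟨ cong (suc ∘ count (remove (mem S) 0)) (m∸n+n≡m (<⇒≤ m<F)) ⟨
    suc (count (remove (mem S) 0) ((F ∸ m) + m)) ≡⟨ cong suc (count-interval m (F ∸ m) nothing-below inside) ⟩
    suc (F ∸ m)                            ∎
    where
    open ≡-Reasoning
    nothing-below : ∀ x → x < m → x ∉ᵇ remove (mem S) 0
    nothing-below zero    _   = remove-self (mem S) 0
    nothing-below (suc x) x<m = remove-∉ᵇ (mem S) 0 (below-m (suc x) (s≤s z≤n) x<m)
    inside : ∀ x → m ≤ x → x < (F ∸ m) + m → x ∈ᵇ remove (mem S) 0
    inside x m≤x x<F = remove⁺ (mem S) 0 (between x m≤x (subst (x <_) (m∸n+n≡m (<⇒≤ m<F)) x<F))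
                         (λ { refl → <⇒≱ m>0 m≤x })

  genus≡ : genus S ≡ m
  genus≡ = begin
    genus S                          ≡⟨ m+n∸n≡m (genus S) (nS S) ⟨
    genus S + nS S ∸ nS S            ≡⟨ cong₂ _∸_ (genus+nS S (proj₁ hasFrobenius)) nS≡ ⟩
    suc (frob S) ∸ suc (F ∸ m)       ≡⟨ cong (λ f → suc f ∸ suc (F ∸ m)) frob≡ ⟩
    F ∸ (F ∸ m)                      ≡⟨ m∸[m∸n]≡n (<⇒≤ m<F) ⟩
    m                                ∎
    where open ≡-Reasoning

  isSpecial : IsSpecial S
  isSpecial (h , (h∉S , _) , h≢frob , mult<h) with <-cmp h F
  ... | tri< h<F _ _ = ∈ᵇ⇒¬∉ᵇ (between h (<⇒≤ (subst (_< h) mult≡ mult<h)) h<F) h∉S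
  ... | tri≈ _ h≡F _ = h≢frob (trans h≡F (sym frob≡))
  ... | tri> _ _ F<h = ∈ᵇ⇒¬∉ᵇ (proj₂ hasFrobenius h F<h) h∉S

almostOrdinary-numSemigroup : ∀ {P m F} → AlmostOrdinary P m F → F < 2 * m → NumSemigroup
almostOrdinary-numSemigroup {P} {m} {F} (zero∈ , below-m , _ , _ , above-F) F<2m = record
  { mem      = P
  ; bound    = suc F
  ; has0     = zero∈
  ; closed   = closed′
  ; cofinite = above-F
  }
  where
  nonzero≥m : ∀ x → x ∈ᵇ P → x ≢ 0 → m ≤ x
  nonzero≥m x x∈P x≢0 with m Data.Nat.≤? x
  ... | yes m≤x = m≤x
  ... | no  m≰x = ⊥-elim (∈ᵇ⇒¬∉ᵇ x∈P (below-m x (n≢0⇒n>0 x≢0) (≰⇒> m≰x)))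
  closed′ : ∀ x y → x ∈ᵇ P → y ∈ᵇ P → (x + y) ∈ᵇ P
  closed′ x y x∈P y∈P with x ≟ 0 | y ≟ 0
  ... | yes refl | _        = y∈P
  ... | no  _    | yes refl = subst (_∈ᵇ P) (sym (+-identityʳ x)) x∈P
  ... | no  x≢0  | no  y≢0  = above-F (x + y) (<-≤-trans F<2m (subst (_≤ x + y) (sym (2*-≡-+ m))
                                 (+-mono-≤ (nonzero≥m x x∈P x≢0) (nonzero≥m y y∈P y≢0))))

private
  ≤ᵇ-true : ∀ {a b} → a ≤ b → (a ≤ᵇ b) ≡ true
  ≤ᵇ-true a≤b = Equivalence.to T-≡ (≤⇒≤ᵇ a≤b)

  ≤ᵇ-false : ∀ {a b} → ¬ a ≤ b → (a ≤ᵇ b) ≡ false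
  ≤ᵇ-false {a} {b} a≰b = ¬∈ᵇ⇒∉ᵇ (a≰b ∘ ≤ᵇ⇒≤ a b ∘ Equivalence.from T-≡)

  <ᵇ-true : ∀ {a b} → a < b → (a <ᵇ b) ≡ true
  <ᵇ-true a<b = Equivalence.to T-≡ (<⇒<ᵇ a<b)

  <ᵇ-false : ∀ {a b} → ¬ a < b → (a <ᵇ b) ≡ false
  <ᵇ-false {a} {b} a≮b = ¬∈ᵇ⇒∉ᵇ (a≮b ∘ <ᵇ⇒< a b ∘ Equivalence.from T-≡)

Sgn-almostOrdinary : ∀ g n → 2 ≤ n → AlmostOrdinary (Sgn (suc g) n) (suc g) (g + n)
Sgn-almostOrdinary g n 2≤n = refl , below , between , atF , aboveF
  where
  F>0 : 0 < g + n
  F>0 = ≤-trans (≤-trans (s≤s z≤n) 2≤n) (m≤n+m n g)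
  below : ∀ z → 0 < z → z < suc g → Sgn (suc g) n z ≡ false
  below z z>0 z<g rewrite ≢-≡ᵇ z 0 (<⇒≢ z>0 ∘ sym) | ≤ᵇ-false {suc g} {z} (<⇒≱ z<g)
    | ≤ᵇ-false {suc (g + n)} {z} (<⇒≱ (≤-trans z<g (s≤s (m≤m+n g n)))) = refl
  between : ∀ z → suc g ≤ z → z < g + n → Sgn (suc g) n z ≡ true
  between z g<z z<F rewrite ≢-≡ᵇ z 0 (<⇒≢ (≤-trans (s≤s z≤n) g<z) ∘ sym) | ≤ᵇ-true g<z | <ᵇ-true z<F = refl
  atF : Sgn (suc g) n (g + n) ≡ false
  atF rewrite ≢-≡ᵇ (g + n) 0 (<⇒≢ F>0 ∘ sym) | ≤ᵇ-true {suc g} {g + n} (m<m+n g (≤-trans (s≤s z≤n) 2≤n))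
    | <ᵇ-false {g + n} {g + n} (<-irrefl refl) = refl
  aboveF : ∀ z → g + n < z → Sgn (suc g) n z ≡ true
  aboveF z F<z rewrite ≢-≡ᵇ z 0 (<⇒≢ (<-trans F>0 F<z) ∘ sym) | ≤ᵇ-true F<z
    | ≤ᵇ-true {suc g} {z} (≤-trans (s≤s (m≤m+n g n)) F<z) | <ᵇ-false (<⇒≯ F<z) = refl

Sgn-numSemigroup : ∀ g n → 2 ≤ n → n ≤ suc g → NumSemigroup
Sgn-numSemigroup g n 2≤n n≤1+g = almostOrdinary-numSemigroup (Sgn-almostOrdinary g n 2≤n) F<2m
  where
  F<2m : g + n < 2 * suc g
  F<2m = begin-strict
    g + n          ≤⟨ +-monoʳ-≤ g n≤1+g ⟩
    g + suc g      <⟨ n<1+n _ ⟩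
    suc g + suc g  ≡⟨ 2*-≡-+ (suc g) ⟨
    2 * suc g      ∎
    where open ≤-Reasoning

count-symmetric-cover : ∀ P F → (∀ z → z ≤ F → 2 * z ≢ F → z ∈ᵇ P ⊎ (F ∸ z) ∈ᵇ P) →
                        F ≤ count P (suc F) + count P (suc F)
count-symmetric-cover P F cover = +-cancelʳ-≤ 1 F _ (begin
  F + 1                                              ≡⟨ +-comm F 1 ⟩
  suc F                                              ≡⟨ count-complement covered (suc F) ⟨
  count covered (suc F) + count (not ∘ covered) (suc F) ≤⟨ +-mono-≤ covered≤ (count-≤1 (suc F) at-most-one) ⟩
  count P (suc F) + count P (suc F) + 1              ∎)
  where
  open ≤-Reasoning
  covered : ℕ → Bool
  covered z = P z ∨ P (F ∸ z)
  covered≤ : count covered (suc F) ≤ count P (suc F) + count P (suc F)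
  covered≤ = ≤-trans (count-∨ P (λ z → P (F ∸ z)) (suc F))
                     (≤-reflexive (cong (count P (suc F) +_) (count-reflect P F)))
  uncovered-half : ∀ z → z < suc F → not (covered z) ≡ true → 2 * z ≡ F
  uncovered-half z z≤F uncovered with 2 * z ≟ F
  ... | yes 2z≡F = 2z≡F
  ... | no  2z≢F with cover z (m<1+n⇒m≤n z≤F) 2z≢F
  ...   | inj₁ z∈P   = ⊥-elim (∈ᵇ⇒¬∉ᵇ z∈P (∨-conicalˡ _ _ (not-injective uncovered)))
  ...   | inj₂ F∸z∈P = ⊥-elim (∈ᵇ⇒¬∉ᵇ F∸z∈P (∨-conicalʳ _ _ (not-injective uncovered)))
  at-most-one : ∀ x y → x < suc F → y < suc F → not (covered x) ≡ true → not (covered y) ≡ true → x ≡ y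
  at-most-one x y x≤F y≤F ux uy = *-cancelˡ-≡ x y 2 (trans (uncovered-half x x≤F ux) (sym (uncovered-half y y≤F uy)))

genus>0⇒gap : ∀ S → 0 < genus S → ∃ λ x → x ∉ᵇ mem S
genus>0⇒gap S genus>0 =
  let x , _ , x∉S = count-witness (bound S) (subst (0 <_) (length-filterᵇ-upTo (not ∘ mem S) (bound S)) genus>0)
  in  x , not-injective x∉S

nS≥2⇒mult<frob : ∀ S {x} → x ∉ᵇ mem S → 2 ≤ nS S → mult S < frob S
nS≥2⇒mult<frob S x∉S 2≤nS with <-cmp (mult S) (frob S)
... | tri< m<F _ _ = m<F
... | tri≈ _ m≡F _ = ⊥-elim (∈ᵇ⇒¬∉ᵇ (mult∈ S) (subst (_∉ᵇ mem S) (sym m≡F) (frob-gap S x∉S)))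
... | tri> _ _ F<m = ⊥-elim (<⇒≱ 2≤nS (≤-trans (≤-reflexive (length-filterᵇ-upTo (mem S) (frob S)))
                                              (count-≤1 (frob S) only-zero)))
  where
  zero-only : ∀ z → z < frob S → z ∈ᵇ mem S → z ≡ 0
  zero-only z z<F z∈S with z ≟ 0
  ... | yes z≡0 = z≡0
  ... | no  z≢0 = ⊥-elim (∈ᵇ⇒¬∉ᵇ z∈S (mult-minimal S z (n≢0⇒n>0 z≢0) (<-trans z<F F<m)))
  only-zero : ∀ a b → a < frob S → b < frob S → a ∈ᵇ mem S → b ∈ᵇ mem S → a ≡ b
  only-zero a b a<F b<F a∈S b∈S = trans (zero-only a a<F a∈S) (sym (zero-only b b<F b∈S))

module SpecialSemigroup (S : NumSemigroup) (special : IsSpecial S) {x} (x∉S : x ∉ᵇ mem S) where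

  private
    F = frob S
    m = mult S
    frobF = frob-hasFrobenius S x∉S
  open HalfFrobenius S frobF

  -- S being special, the special gap v > F/2 above z is at most m
  gap-pair-bounded : ∀ {z} → z ∉ᵇ mem S → (F ∸ z) ∉ᵇ mem S → 2 * z ≢ F → z ≤ m × F < 2 * m
  gap-pair-bounded z∉S F∸z∉S 2z≢F =
    let v , v-special , v≢F , z≤v , F<2v = specialGap-above-half z∉S F∸z∉S 2z≢F
        v≤m = ≮⇒≥ (λ m<v → special (v , v-special , v≢F , m<v))
    in  ≤-trans z≤v v≤m , <-≤-trans F<2v (*-monoʳ-≤ 2 v≤m)

  2m<F⇒symmetric-cover : 2 * m < F → ∀ z → z ≤ F → 2 * z ≢ F → z ∈ᵇ mem S ⊎ (F ∸ z) ∈ᵇ mem S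
  2m<F⇒symmetric-cover 2m<F z _ 2z≢F with ∈ᵇ-or-∉ᵇ (mem S) z | ∈ᵇ-or-∉ᵇ (mem S) (F ∸ z)
  ... | inj₁ z∈S | _          = inj₁ z∈S
  ... | inj₂ _   | inj₁ F∸z∈S = inj₂ F∸z∈S
  ... | inj₂ z∉S | inj₂ F∸z∉S = ⊥-elim (<-asym 2m<F (proj₂ (gap-pair-bounded z∉S F∸z∉S 2z≢F)))

  F<2m⇒almostOrdinary : m < F → F < 2 * m → AlmostOrdinary (mem S) m F
  F<2m⇒almostOrdinary m<F F<2m = has0 S , mult-minimal S , between , frobF
    where
    F∸m<m : F ∸ m < m
    F∸m<m = +-cancelʳ-< m (F ∸ m) m
              (subst (_< m + m) (sym (m∸n+n≡m (<⇒≤ m<F))) (subst (F <_) (2*-≡-+ m) F<2m))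
    between : ∀ z → m ≤ z → z < F → z ∈ᵇ mem S
    between z m≤z z<F = ¬∉ᵇ⇒∈ᵇ λ z∉S →
      let m<z     = ≤∧≢⇒< m≤z (λ { refl → ∈ᵇ⇒¬∉ᵇ (mult∈ S) z∉S })
          F∸z∉S   = mult-minimal S (F ∸ z) (m<n⇒0<n∸m z<F) (<-trans (∸-monoʳ-< m<z (<⇒≤ z<F)) F∸m<m)
          2z≢F    = λ 2z≡F → <⇒≱ F<2m (≤-trans (*-monoʳ-≤ 2 m≤z) (≤-reflexive 2z≡F))
      in  <⇒≱ m<z (proj₁ (gap-pair-bounded z∉S F∸z∉S 2z≢F))

special⇒Sgn : ∀ g n S → 3 < g → 2 ≤ n → n ≤ g ∸ 2 → IsSpecial S → genus S ≡ g → nS S ≡ n → mem S ≐ Sgn g n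
special⇒Sgn (suc g) n S 3<1+g 2≤n n≤g∸1 special genusS≡ nSS≡ with genus>0⇒gap S (subst (0 <_) (sym genusS≡) (s≤s z≤n))
... | x , x∉S with <-cmp (2 * mult S) (frob S)
...   | tri< 2m<F _ _ = ⊥-elim (<⇒≱ n<g (+-cancelʳ-≤ n g n (≤-pred (begin
  suc g + n                     ≡⟨ cong₂ _+_ genusS≡ nSS≡ ⟨
  genus S + nS S                ≡⟨ genus+nS S x∉S ⟩
  suc (frob S)                  ≤⟨ s≤s (count-symmetric-cover (mem S) (frob S) (2m<F⇒symmetric-cover 2m<F)) ⟩
  suc (c + c)                   ≡⟨ cong (λ k → suc (k + k)) (trans (sym (nS-count S x∉S)) nSS≡) ⟩
  suc (n + n)                   ∎))))
  where
  open SpecialSemigroup S special x∉S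
  open ≤-Reasoning
  c = count (mem S) (suc (frob S))
  n<g : n < g
  n<g = ≤-<-trans n≤g∸1 (∸-monoʳ-< {g} {1} {0} (s≤s z≤n) (≤-trans (s≤s z≤n) (≤-pred 3<1+g)))
...   | tri≈ _ 2m≡F _ = ⊥-elim (∈ᵇ⇒¬∉ᵇ 2m∈S (subst (_∉ᵇ mem S) (sym 2m≡F) (frob-gap S x∉S)))
  where
  2m∈S = subst (_∈ᵇ mem S) (sym (2*-≡-+ (mult S))) (closed S _ _ (mult∈ S) (mult∈ S))
...   | tri> _ _ F<2m = almostOrdinary-unique (subst₂ (AlmostOrdinary (mem S)) m≡1+g F≡g+n shape)
                                            (Sgn-almostOrdinary g n 2≤n)
  where
  open SpecialSemigroup S special x∉S
  m<F = nS≥2⇒mult<frob S x∉S (subst (2 ≤_) (sym nSS≡) 2≤n)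
  shape = F<2m⇒almostOrdinary m<F F<2m
  open AlmostOrdinarySemigroup S (mult>0 S) m<F shape
  m≡1+g : mult S ≡ suc g
  m≡1+g = trans (sym genus≡) genusS≡
  F≡g+n : frob S ≡ g + n
  F≡g+n = begin
    frob S                        ≡⟨ m+[n∸m]≡n (<⇒≤ m<F) ⟨
    mult S + (frob S ∸ mult S)    ≡⟨ cong (_+ (frob S ∸ mult S)) m≡1+g ⟩
    suc g + (frob S ∸ mult S)     ≡⟨ +-suc g _ ⟨
    g + suc (frob S ∸ mult S)     ≡⟨ cong (g +_) (trans (sym nS≡) nSS≡) ⟩
    g + n                         ∎
    where open ≡-Reasoning

-- Children in the tree

removed-isSpecialGap : ∀ (Q : NumSemigroup) {y} → y ∈ᵇ mem Q → y ≢ 0 → IsSpecialGap (remove (mem Q) y) y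
removed-isSpecialGap Q {y} y∈Q y≢0 =
  remove-self (mem Q) y ,
  remove⁺ (mem Q) y (subst (_∈ᵇ mem Q) (sym (2*-≡-+ y)) (closed Q y y y∈Q y∈Q)) (y+s≢y y≢0 ∘ trans (sym (2*-≡-+ y))) ,
  λ s s∈ s≢0 → remove⁺ (mem Q) y (closed Q y s y∈Q (proj₁ (remove⁻ (mem Q) y s s∈))) (y+s≢y s≢0)
  where
  y+s≢y : ∀ {s} → s ≢ 0 → y + s ≢ y
  y+s≢y s≢0 = <⇒≢ (m<m+n y (n≢0⇒n>0 s≢0)) ∘ sym

gap-isMinGen-insert : ∀ (S : NumSemigroup) {h} → h ∉ᵇ mem S → IsMinGen (insert (mem S) h) h
gap-isMinGen-insert S {h} h∉S = insert-self (mem S) h , gap≢0 S h∉S , indecomposable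
  where
  indecomposable : ∀ a b → a ∈ᵇ insert (mem S) h → b ∈ᵇ insert (mem S) h → a ≢ 0 → b ≢ 0 → a + b ≢ h
  indecomposable a b a∈ b∈ a≢0 b≢0 with insert⁻ (mem S) h a a∈ | insert⁻ (mem S) h b b∈
  ... | inj₂ refl | _         = <⇒≢ (m<m+n a (n≢0⇒n>0 b≢0)) ∘ sym
  ... | inj₁ _    | inj₂ refl = <⇒≢ (m<n+m b (n≢0⇒n>0 a≢0)) ∘ sym
  ... | inj₁ a∈S  | inj₁ b∈S  = λ a+b≡h → ∈ᵇ⇒¬∉ᵇ (closed S a b a∈S b∈S) (subst (_∉ᵇ mem S) (sym a+b≡h) h∉S)

insert-specialGap-above : ∀ {P h k} → IsSpecialGap (insert P h) k → h < k → IsSpecialGap P k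
insert-specialGap-above {P} {h} {k} (k∉ , 2k∈ , k+s∈) h<k =
  trans (sym (unchanged ≤-refl)) k∉ ,
  trans (sym (unchanged (m≤m+n k (k + 0)))) 2k∈ ,
  λ s s∈P s≢0 → trans (sym (unchanged (m≤m+n k s))) (k+s∈ s (insert⁺ P h s∈P) s≢0)
  where
  unchanged : ∀ {z} → k ≤ z → insert P h z ≡ P z
  unchanged k≤z = insert-≢ P (λ { refl → <⇒≱ h<k k≤z })

remove-specialGap-above : ∀ {P y x F} → (∀ z → F < z → z ∈ᵇ P) → F < 2 * y →
                          IsSpecialGap (remove P y) x → y < x → IsSpecialGap P x
remove-specialGap-above {P} {y} {x} {F} above F<2y (x∉ , 2x∈ , x+s∈) y<x =
  trans (sym (remove-≢ P (<⇒≢ y<x ∘ sym))) x∉ ,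
  proj₁ (remove⁻ P y _ 2x∈) ,
  x+s∈P
  where
  x+s∈P : ∀ s → s ∈ᵇ P → s ≢ 0 → (x + s) ∈ᵇ P
  x+s∈P s s∈P s≢0 with s ≟ y
  ... | yes refl = above (x + s) (<-≤-trans F<2y (subst (_≤ x + s) (sym (2*-≡-+ s)) (+-monoˡ-≤ s (<⇒≤ y<x))))
  ... | no  s≢y  = proj₁ (remove⁻ P y _ (x+s∈ s (remove⁺ P y s∈P s≢y) s≢0))

module ChildOfA (S T : NumSemigroup) (nonSpecial : NonSpecial S) {h : ℕ}
                (h-greatest : GreatestOtherSpecialGap S h)
                (T≐ : mem T ≐ remove (insert (mem S) h) (mult S)) where

  open AStep S T nonSpecial h-greatest T≐

  private
    m = mult S
    h∉S = proj₁ h-special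
    S∪h = addSpecialGap S h h-special

  T∪m≐S∪h : insert (mem T) m ≐ insert (mem S) h
  T∪m≐S∪h = ≐-trans (insert-cong m T≐) (insert-remove (insert (mem S) h) m (insert⁺ (mem S) h (mult∈ S)))

  mult-isSpecialGap : IsSpecialGap (mem T) m
  mult-isSpecialGap = IsSpecialGap-cong (≐-sym T≐)
    (removed-isSpecialGap S∪h (insert⁺ (mem S) h (mult∈ S)) (<⇒≢ (mult>0 S) ∘ sym))

  h-isMinGen : IsMinGen (insert (mem T) m) h
  h-isMinGen = IsMinGen-cong (≐-sym T∪m≐S∪h) (gap-isMinGen-insert S h∉S)

  S≐ : mem S ≐ remove (insert (mem T) m) h
  S≐ = remove-insert-swap h m h∉S (mult∈ S) (<⇒≢ mult<h ∘ sym) T≐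

  F<2h : frob T < 2 * h
  F<2h = subst (_< 2 * h) (sym frob-preserved) (greatestSpecialGap-above-half h-greatest)
    where open HalfFrobenius S (frob-hasFrobenius S h∉S)

  h<F : h < frob T
  h<F = subst (h <_) (sym frob-preserved) h<frob

  -- the special gaps of T ∪ {m} = S ∪ {h} above h are special gaps of S, and h is the greatest of those
  otherSpecialGaps<h : ¬ Irreducible (insert (mem T) m) →
    ∃ λ k → IsMaxOf (λ x → IsSpecialGap (insert (mem T) m) x × x ≢ frob T) k × k < h
  otherSpecialGaps<h reducible =
    let k₀ , k₀-special , k₀≢F = ¬Irreducible⇒otherSpecialGap T∪m frobT∪m reducible
        k , k-greatest@((k-special , k≢F) , _) = greatestSpecialGap T∪m (λ x → ¬? (x ≟ frob T)) k₀-special k₀≢F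
    in  k , k-greatest , k<h k-special k≢F
    where
    T∪m = addSpecialGap T m mult-isSpecialGap
    frobT∪m : HasFrobenius (insert (mem T) m) (frob T)
    frobT∪m = insert-∉ᵇ (mem T) m (proj₁ (frob-hasFrobenius T (proj₁ mult-isSpecialGap))) F≢m ,
              λ z F<z → insert⁺ (mem T) m (proj₂ (frob-hasFrobenius T (proj₁ mult-isSpecialGap)) z F<z)
      where
      F≢m : frob T ≢ m
      F≢m F≡m = <-asym mult<h (subst (h <_) F≡m h<F)
    k<h : ∀ {k} → IsSpecialGap (insert (mem T) m) k → k ≢ frob T → k < h
    k<h {k} k-special k≢F with <-cmp k h
    ... | tri< k<h _ _ = k<h
    ... | tri≈ _ refl _ = ⊥-elim (∈ᵇ⇒¬∉ᵇ (trans (T∪m≐S∪h k) (insert-self (mem S) k)) (proj₁ k-special))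
    ... | tri> _ _ h<k = ⊥-elim (<⇒≱ h<k (proj₂ h-greatest k
                          (insert-specialGap-above (IsSpecialGap-cong T∪m≐S∪h k-special) h<k ,
                           λ k≡F → k≢F (trans k≡F (sym frob-preserved)))))

  childData : ChildData T m h
  childData =
    mult-isSpecialGap , mult-increases , h-isMinGen , (<⇒≢ mult<h ∘ sym) ,
    (λ _ → F<2h , h<F) ,
    (λ reducible → let k , k-greatest , k<h = otherSpecialGaps<h reducible in k , k-greatest , k<h , h<F)

A⇒childData : ∀ S T → NonSpecial S → IsA S T → ∃₂ λ h y → ChildData T h y × (mem S ≐ remove (insert (mem T) h) y)
A⇒childData S T nonSpecial (h , h-greatest , T≐) = mult S , h , childData , S≐
  where open ChildOfA S T nonSpecial h-greatest T≐

module ParentOfChildData (T : NumSemigroup) {x₀} (x₀∉T : x₀ ∉ᵇ mem T) (mT<F : mult T < frob T) {h y : ℕ}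
  (h-special : IsSpecialGap (mem T) h) (h<mT : h < mult T)
  (y-minGen : IsMinGen (insert (mem T) h) y) (y≢h : y ≢ h)
  (irreducible-case : Irreducible (insert (mem T) h) → frob T < 2 * y × y < frob T)
  (reducible-case : ¬ Irreducible (insert (mem T) h) →
     ∃ λ k → IsMaxOf (λ x → IsSpecialGap (insert (mem T) h) x × x ≢ frob T) k × k < y × y < frob T) where

  private
    F = frob T
    h∉T = proj₁ h-special
    h<F = <-trans h<mT mT<F
    T∪h = addSpecialGap T h h-special
    y∈T∪h = proj₁ y-minGen

  S : NumSemigroup
  S = removeMinGen T∪h y y-minGen

  y∈T : y ∈ᵇ mem T
  y∈T with insert⁻ (mem T) h y y∈T∪h
  ... | inj₁ y∈T = y∈T
  ... | inj₂ y≡h = ⊥-elim (y≢h y≡h)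

  h<y : h < y
  h<y = <-≤-trans h<mT (mult≤ T (n≢0⇒n>0 (proj₁ (proj₂ y-minGen))) y∈T)

  frobT∪h : HasFrobenius (insert (mem T) h) F
  frobT∪h = insert-∉ᵇ (mem T) h (proj₁ (frob-hasFrobenius T x₀∉T)) (<⇒≢ h<F ∘ sym) ,
            λ z F<z → insert⁺ (mem T) h (proj₂ (frob-hasFrobenius T x₀∉T) z F<z)

  y-bounds : y < F × F < 2 * y × (∀ k → IsSpecialGap (insert (mem T) h) k → k ≢ F → k < y)
  y-bounds with anySpecialGap? T∪h (λ k → ¬? (k ≟ F))
  ... | no none =
    let F<2y , y<F = irreducible-case (onlyFrobeniusSpecial⇒Irreducible T∪h frobT∪h only-F)
    in  y<F , F<2y , λ k k-special k≢F → ⊥-elim (k≢F (only-F k k-special))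
    where
    only-F : ∀ k → IsSpecialGap (insert (mem T) h) k → k ≡ F
    only-F k k-special with k ≟ F
    ... | yes k≡F = k≡F
    ... | no  k≢F = ⊥-elim (none (k , k-special , k≢F))
  ... | yes (k₀ , k₀-special , k₀≢F) =
    let k , k-greatest , k<y , y<F = reducible-case (otherSpecialGap⇒¬Irreducible T∪h frobT∪h k₀-special k₀≢F)
    in  y<F , <-trans (greatestSpecialGap-above-half k-greatest) (*-monoʳ-< 2 k<y) ,
        λ k′ k′-special k′≢F → ≤-<-trans (proj₂ k-greatest k′ (k′-special , k′≢F)) k<y
    where open HalfFrobenius T∪h frobT∪h

  open Exchange T S h∉T y∈T h<F (proj₁ y-bounds) (λ _ → refl) public

  mult≡h : mult S ≡ h
  mult≡h = mult-unique S (remove⁺ (insert (mem T) h) y (insert-self (mem T) h) (y≢h ∘ sym))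
                         (n≢0⇒n>0 (gap≢0 T h∉T)) below-h
    where
    below-h : ∀ z → 0 < z → z < h → z ∉ᵇ mem S
    below-h z z>0 z<h = remove-∉ᵇ (insert (mem T) h) y
      (insert-∉ᵇ (mem T) h (mult-minimal T z z>0 (<-trans z<h h<mT)) (<⇒≢ z<h))

  y-greatest : GreatestOtherSpecialGap S y
  y-greatest = (y-special , y≢F) , below-y
    where
    y-special = removed-isSpecialGap T∪h y∈T∪h (proj₁ (proj₂ y-minGen))
    y≢F : y ≢ frob S
    y≢F y≡F = <⇒≢ (proj₁ y-bounds) (trans y≡F frob-preserved)
    below-y : ∀ k → IsSpecialGap (mem S) k × k ≢ frob S → k ≤ y
    below-y k (k-special , k≢F) = ≮⇒≥ λ y<k → <-asym y<k (proj₂ (proj₂ y-bounds) k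
      (remove-specialGap-above (proj₂ frobT∪h) (proj₁ (proj₂ y-bounds)) k-special y<k)
      (λ k≡F → k≢F (trans k≡F (sym frob-preserved))))

  nonSpecial : NonSpecial S
  nonSpecial special = special (y , proj₁ (proj₁ y-greatest) , proj₂ (proj₁ y-greatest) , subst (_< y) (sym mult≡h) h<y)

  isA : IsA S T
  isA = y , y-greatest , T≐
    where
    T≐ : mem T ≐ remove (insert (mem S) y) (mult S)
    T≐ rewrite mult≡h = remove-insert-swap h y h∉T y∈T (<⇒≢ h<y) (λ _ → refl)

childData⇒A : ∀ T {x} → x ∉ᵇ mem T → mult T < frob T → ∀ {h y} → ChildData T h y →
  Σ NumSemigroup λ S → (mem S ≐ remove (insert (mem T) h) y) × NonSpecial S × genus S ≡ genus T × nS S ≡ nS T × IsA S T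
childData⇒A T x∉T mT<F (h-special , h<mT , y-minGen , y≢h , irreducible-case , reducible-case) =
  S , (λ _ → refl) , nonSpecial , genus-preserved , nS-preserved , isA
  where open ParentOfChildData T x∉T mT<F h-special h<mT y-minGen y≢h irreducible-case reducible-case

-- The rooted tree

snoc-singleton : ∀ {A : Set} {v e : A} t → v ∷ [] ≡ t ∷ʳ e → v ≡ e
snoc-singleton t eq = proj₂ (∷ʳ-injective [] t eq)

snoc-tail : ∀ {A : Set} {v w e : A} {ws} t → v ∷ w ∷ ws ≡ t ∷ʳ e → ∃ λ t′ → w ∷ ws ≡ t′ ∷ʳ e
snoc-tail []      ()
snoc-tail (_ ∷ t) eq = t , ∷-injectiveʳ eq

module RootedTree (g n : ℕ) (3<g : 3 < suc g) (2≤n : 2 ≤ n) (n≤g∸1 : n ≤ suc g ∸ 2) where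

  open Graph _≈S_ (InH (suc g) n) (Edge (suc g) n)

  root : NumSemigroup
  root = Sgn-numSemigroup g n 2≤n (≤-trans n≤g∸1 (≤-trans (m∸n≤m g 1) (n≤1+n g)))

  private
    g<F : suc g < g + n
    g<F = subst (_≤ g + n) (+-comm g 2) (+-monoʳ-≤ g 2≤n)

  Sgn-special : ∀ S → mem S ≐ Sgn (suc g) n → IsSpecial S
  Sgn-special S S≐ = AlmostOrdinarySemigroup.isSpecial S (s≤s z≤n) g<F
                       (almostOrdinary-cong S≐ (Sgn-almostOrdinary g n 2≤n))

  single-edge-path : ∀ {S T} → Edge (suc g) n S T → mem T ≐ Sgn (suc g) n → IsPath S root (S ∷ T ∷ [])
  single-edge-path {S} {T} edge T≐ = record
    { vertices = proj₁ edge ∷ inj₁ T≐ ∷ []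
    ; linked   = edge ∷ [-]
    ; distinct = [] ∷ []
    ; start    = S , T ∷ [] , refl , (λ _ → refl)
    ; end      = S ∷ [] , T , refl , T≐
    }

  extend-path : ∀ {S T t} → Edge (suc g) n S T → mult S < mult T → All (λ v → mult T ≤ mult v) (T ∷ t) →
                IsPath T root (T ∷ t) → IsPath S root (S ∷ T ∷ t)
  extend-path {S} {T} {t} edge mS<mT later path = record
    { vertices = proj₁ edge ∷ IsPath.vertices path
    ; linked   = edge ∷ IsPath.linked path
    ; distinct = first-edge-new (T ∷ t) t later ∷ IsPath.distinct path
    ; start    = S , T ∷ t , refl , (λ _ → refl)
    ; end      = let t₀ , v , eq , v≈r = IsPath.end path in S ∷ t₀ , v , cong (S ∷_) eq , v≈r
    }
    where
    first-edge-new : ∀ vs ws → All (λ v → mult T ≤ mult v) vs → All (λ e → ¬ ((S , T) ≈E e)) (zip vs ws)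
    first-edge-new []       _        []           = []
    first-edge-new (_ ∷ _)  []       (_ ∷ _)      = []
    first-edge-new (v ∷ vs) (w ∷ ws) (mT≤mv ∷ rest) =
      (λ (S≈v , _) → <⇒≢ (<-≤-trans mS<mT mT≤mv) (mult-cong {S} {v} S≈v)) ∷ first-edge-new vs ws rest

  path-to-root : ∀ S → Acc _<_ (frob S ∸ mult S) → NonSpecial S → genus S ≡ suc g → nS S ≡ n →
                 ∃ λ t → IsPath S root (S ∷ t) × All (λ v → mult S ≤ mult v) (S ∷ t)
  path-to-root S (acc smaller) nonSpecial genus≡ nS≡ with A-exists S nonSpecial
  ... | T , isA@(_ , h-greatest , T≐) = continue (isSpecial? T)
    where
    open AStep S T nonSpecial h-greatest T≐
    edge : Edge (suc g) n S T
    edge = inj₂ (nonSpecial , genus≡ , nS≡) , nonSpecial , isA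
    genusT = trans genus-preserved genus≡
    nST = trans nS-preserved nS≡
    continue : Dec (IsSpecial T) → ∃ λ t → IsPath S root (S ∷ t) × All (λ v → mult S ≤ mult v) (S ∷ t)
    continue (yes special) =
      T ∷ [] , single-edge-path edge (special⇒Sgn (suc g) n T 3<g 2≤n n≤g∸1 special genusT nST) ,
      ≤-refl ∷ <⇒≤ mult-increases ∷ []
    continue (no nonSpecialT) =
      let t , path , later = path-to-root T (smaller shorter) nonSpecialT genusT nST
      in  T ∷ t , extend-path edge mult-increases later path , ≤-refl ∷ All.map (≤-trans (<⇒≤ mult-increases)) later
      where
      shorter : frob T ∸ mult T < frob S ∸ mult S
      shorter = subst (λ f → f ∸ mult T < frob S ∸ mult S) (sym frob-preserved)
                  (∸-monoʳ-< mult-increases (subst (mult T ≤_) frob-preserved (<⇒≤ (nonSpecial-mult<frob T nonSpecialT))))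

  private
    head≈ : ∀ {x v vs} → IsPath x root (v ∷ vs) → v ≈S x
    head≈ path with IsPath.start path
    ... | _ , _ , refl , v≈x = v≈x

    last≈root : ∀ {x v} → IsPath x root (v ∷ []) → v ≈S root
    last≈root path with IsPath.end path
    ... | t , e , eq , e≈r rewrite snoc-singleton t eq = e≈r

    first-edge : ∀ {x v w vs} → IsPath x root (v ∷ w ∷ vs) → Edge (suc g) n v w
    first-edge path with IsPath.linked path
    ... | edge ∷ _ = edge

    tail-path : ∀ {x v w vs y} → w ≈S y → IsPath x root (v ∷ w ∷ vs) → IsPath y root (w ∷ vs)
    tail-path {w = w} {vs} w≈y path with IsPath.vertices path | IsPath.linked path | IsPath.distinct path | IsPath.end path
    ... | _ ∷ vertices | _ ∷ linked | _ ∷ distinct | t , e , eq , e≈r = record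
      { vertices = vertices ; linked = linked ; distinct = distinct
      ; start = w , vs , refl , w≈y
      ; end = let t′ , eq′ = snoc-tail t eq in t′ , e , eq′ , e≈r }

    root-has-no-edge : ∀ {x v w vs} → v ≈S root → IsPath x root (v ∷ w ∷ vs) → ∀ {A : Set} → A
    root-has-no-edge {v = v} v≈r path = ⊥-elim (proj₁ (proj₂ (first-edge path)) (Sgn-special v v≈r))

  path-unique : ∀ x vs ws → IsPath x root vs → IsPath x root ws → Pointwise _≈S_ vs ws
  path-unique x []      _       path _     with IsPath.start path
  ... | _ , _ , () , _
  path-unique x (_ ∷ _) []      _    path′ with IsPath.start path′
  ... | _ , _ , () , _
  path-unique x (v ∷ []) (w ∷ []) path path′ = v≈w ∷ []
    where v≈w = ≐-trans (head≈ path) (≐-sym (head≈ path′))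
  path-unique x (v ∷ []) (w ∷ _ ∷ _) path path′ =
    root-has-no-edge (≐-trans (≐-trans (head≈ path′) (≐-sym (head≈ path))) (last≈root path)) path′
  path-unique x (v ∷ _ ∷ _) (w ∷ []) path path′ =
    root-has-no-edge (≐-trans (≐-trans (head≈ path) (≐-sym (head≈ path′))) (last≈root path′)) path
  path-unique x (v ∷ v₁ ∷ vs) (w ∷ w₁ ∷ ws) path path′ =
    v≈w ∷ path-unique v₁ (v₁ ∷ vs) (w₁ ∷ ws) (tail-path (λ _ → refl) path) (tail-path (≐-sym v₁≈w₁) path′)
    where
    v≈w = ≐-trans (head≈ path) (≐-sym (head≈ path′))
    v₁≈w₁ = A-functional {v} {w} {v₁} {w₁} (proj₂ (proj₂ (first-edge path))) (proj₂ (proj₂ (first-edge path′))) v≈w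

  isRootedTree : IsRootedTree root
  isRootedTree = inj₁ (λ _ → refl) , λ S S∈H S≉root → path-exists S S∈H S≉root , path-unique S
    where
    path-exists : ∀ S → InH (suc g) n S → ¬ (S ≈S root) → ∃ (IsPath S root)
    path-exists S (inj₁ S≐) S≉root = ⊥-elim (S≉root S≐)
    path-exists S (inj₂ (nonSpecial , genus≡ , nS≡)) _ =
      let t , path , _ = path-to-root S (<-wellFounded _) nonSpecial genus≡ nS≡ in S ∷ t , path

  vertex-facts : ∀ T → InH (suc g) n T →
                 (∃ λ x → x ∉ᵇ mem T) × mult T < frob T × genus T ≡ suc g × nS T ≡ n
  vertex-facts T (inj₂ (nonSpecial , genus≡ , nS≡)) =
    let h , (h∉T , _) , _ = nonSpecial-witness T nonSpecial
    in  (h , h∉T) , nonSpecial-mult<frob T nonSpecial , genus≡ , nS≡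
  vertex-facts T (inj₁ T≐) =
    (g + n , proj₁ hasFrobenius) ,
    subst₂ _<_ (sym mult≡) (sym frob≡) g<F , genus≡ , trans nS≡ (suc-[g+n∸1+g] n 2≤n)
    where
    shape = almostOrdinary-cong T≐ (Sgn-almostOrdinary g n 2≤n)
    open AlmostOrdinarySemigroup T (s≤s z≤n) g<F shape
    suc-[g+n∸1+g] : ∀ n → 2 ≤ n → suc (g + n ∸ suc g) ≡ n
    suc-[g+n∸1+g] (suc n) _ = cong suc (trans (cong (_∸ suc g) (+-suc g n)) (m+n∸m≡n g n))

theorem5p6 : (g n : ℕ) → 3 < g → 2 ≤ n → n ≤ g ∸ 2 →
    (Σ NumSemigroup λ r → (mem r ≐ Sgn g n) × Graph.IsRootedTree _≈S_ (InH g n) (Edge g n) r)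
    ×
    (∀ T → InH g n T →
      (∀ S → InH g n S → Edge g n S T →
         ∃₂ λ h y → ChildData T h y × (mem S ≐ remove (insert (mem T) h) y))
      ×
      (∀ h y → ChildData T h y →
         Σ NumSemigroup λ S → (mem S ≐ remove (insert (mem T) h) y) × InH g n S × Edge g n S T))
theorem5p6 zero    n ()  _   _
theorem5p6 (suc g) n 3<g 2≤n n≤g∸2 =
  (root , (λ _ → refl) , isRootedTree) , λ T T∈H → children T , parents T T∈H
  where
  open RootedTree g n 3<g 2≤n n≤g∸2
  children : ∀ T S → InH _ n S → Edge _ n S T → ∃₂ λ h y → ChildData T h y × (mem S ≐ remove (insert (mem T) h) y)
  children T S _ (_ , nonSpecial , isA) = A⇒childData S T nonSpecial isA
  parents : ∀ T → InH _ n T → ∀ h y → ChildData T h y →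
            Σ NumSemigroup λ S → (mem S ≐ remove (insert (mem T) h) y) × InH _ n S × Edge _ n S T
  parents T T∈H h y childData =
    let (x , x∉T) , mT<F , genusT , nST = vertex-facts T T∈H
        S , S≐ , nonSpecial , genusS , nSS , isA = childData⇒A T x∉T mT<F childData
        S∈H = inj₂ (nonSpecial , trans genusS genusT , trans nSS nST)
    in  S , S≐ , S∈H , (S∈H , nonSpecial , isA)
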